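{- There exists an absolute constant $C>0$ such that for every prime power $q$ and every $E\subset\mathbb{F}_q^2$, \[\left| L^2(S_E)-\frac{|E|^8}{q^3}\right|\le C\left(|E|^6+q^2|E|^5\right),\] where $L^2(S_E)$ is the number of tuples $(u_1,v_1,u_2,v_2,u_3,v_3,u_4,v_4)\in E^8$ such that $u_1-v_1=\lambda(u_2-v_2)$ and $u_3-v_3=\lambda(u_4-v_4)$ for some $\lambda\in\mathbb{F}_q\setminus\{0\}$.
   Context: $\mathbb{F}_q$ is the finite field with $q$ elements; $\mathbb{F}_q^2$ is the two-dimensional vector space over it. The paper writes $X\ll Y$ for $X\le CY$ with an absolute constant $C$. -}

module Defs where

open import Level using (0ℓ)
open import Data.Nat using (ℕ)
open import Data.Fin using (Fin)
open import Data.Product using (Σ; _×_; _,_; proj₁; proj₂)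
open import Data.List using (List; map; filter; length; cartesianProduct; allFin)
open import Data.List.Relation.Unary.Any as Any using (Any; any?)
open import Data.List.Membership.Propositional using (_∈_)
open import Data.List.Membership.Propositional.Properties using (∈-map⁺; ∈-allFin; ∈-map⁻)
open import Relation.Nullary using (¬_; Dec; yes; no)
open import Relation.Nullary.Decidable using (_×-dec_; ¬?)
open import Relation.Binary using (DecidableEquality)
open import Relation.Binary.PropositionalEquality using (_≡_; refl; sym; trans; cong; subst)
open import Algebra.Structures using (IsCommutativeRing)
open import Function.Bundles using (_↔_; Inverse)

-- A finite field with exactly q elements (q is then necessarily a prime
-- power, and every prime power arises; F_q is unique up to isomorphism).
record FiniteField (q : ℕ) : Set₁ where
  infixl 7 _*_
  infixl 6 _+_ _-_
  field
    Carrier  : Set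
    _+_ _*_  : Carrier → Carrier → Carrier
    -_       : Carrier → Carrier
    0# 1#    : Carrier
    isCommutativeRing : IsCommutativeRing _≡_ _+_ _*_ -_ 0# 1#
    0≢1      : ¬ (0# ≡ 1#)
    inverse  : (x : Carrier) → ¬ (x ≡ 0#) → Σ Carrier (λ y → x * y ≡ 1#)
    _≟_      : DecidableEquality Carrier
    enum     : Fin q ↔ Carrier

  _-_ : Carrier → Carrier → Carrier
  x - y = x + (- y)

  Point : Set
  Point = Carrier × Carrier

  _⊖_ : Point → Point → Point
  (u₁ , u₂) ⊖ (v₁ , v₂) = (u₁ - v₁ , u₂ - v₂)

  _·_ : Carrier → Point → Point
  c · (w₁ , w₂) = (c * w₁ , c * w₂)

  elements : List Carrier
  elements = map (Inverse.to enum) (allFin q)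

  ∈-elements : (x : Carrier) → x ∈ elements
  ∈-elements x = subst (_∈ elements) (Inverse.strictlyInverseˡ enum x)
                   (∈-map⁺ (Inverse.to enum) (∈-allFin (Inverse.from enum x)))

  _≟P_ : DecidableEquality Point
  (a , b) ≟P (c , d) with a ≟ c | b ≟ d
  ... | yes refl | yes refl = yes refl
  ... | no p | _ = no (λ e → p (cong proj₁ e))
  ... | _ | no p = no (λ e → p (cong proj₂ e))

  Cond : ((Point × Point) × (Point × Point)) × ((Point × Point) × (Point × Point)) → Set
  Cond (((u₁ , v₁) , (u₂ , v₂)) , ((u₃ , v₃) , (u₄ , v₄))) =
    Σ Carrier λ l → ¬ (l ≡ 0#) × ((u₁ ⊖ v₁) ≡ l · (u₂ ⊖ v₂)) × ((u₃ ⊖ v₃) ≡ l · (u₄ ⊖ v₄))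

  Cond? : (t : ((Point × Point) × (Point × Point)) × ((Point × Point) × (Point × Point))) → Dec (Cond t)
  Cond? t@(((u₁ , v₁) , (u₂ , v₂)) , ((u₃ , v₃) , (u₄ , v₄)))
    with any? (λ l → ¬? (l ≟ 0#) ×-dec (((u₁ ⊖ v₁) ≟P (l · (u₂ ⊖ v₂))) ×-dec ((u₃ ⊖ v₃) ≟P (l · (u₄ ⊖ v₄))))) elements
  ... | yes a = yes (let (l , p) = Any.satisfied a in l , p)
  ... | no na = no (λ { (l , p) → na (Any.map (λ { refl → p }) (∈-elements l)) })

  L² : List Point → ℕ
  L² E = length (filter Cond? (cartesianProduct (cartesianProduct EE EE) (cartesianProduct EE EE)))
    where EE = cartesianProduct E E

{-# OPTIONS --safe #-}
-- For λ ∈ F_q let N λ be the number of (u₁, v₁, u₂, v₂) ∈ E⁴ with u₁ - v₁ = λ (u₂ - v₂). Up to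
-- tuples with u₁ = v₁, L²(S_E) is Σ_λ (N λ)², so N λ has to be close to its mean |E|⁴ / q² on
-- average. Counting collisions of (u, v) ↦ u - λ v gives |E|⁴ ≤ q² N λ, and trivially N λ ≤ |E|³;
-- since x² ≤ (a + k) x - a k whenever a ≤ x ≤ k, the second moment Σ_λ (N λ)² is controlled by the
-- first moment Σ_λ N λ. That one counts pairs of differences lying on a common line through 0. The
-- same second-moment argument, applied to the number pairsAlong y of pairs in E² whose difference is
-- parallel to y (for which |E|² ≤ q · pairsAlong y ≤ q² |E| when y ≠ 0), bounds it by
-- |E|⁴ / q + 5 q² |E|².
module Submission where

open import Defs
open import Data.Nat as ℕ using (ℕ)
open import Data.List using (List; length)
open import Data.List.Relation.Unary.Unique.Propositional using (Unique)
open import Data.Product using (Σ; _×_; _,_)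

module FiniteSum where

  open import Level using (0ℓ)
  open import Data.Empty using (⊥-elim)
  open import Data.Nat
  open import Data.Nat.Properties
  open import Data.Nat.Tactic.RingSolver using (solve-∀)
  open import Algebra.Properties.CommutativeSemigroup +-commutativeSemigroup using (interchange; x∙yz≈y∙xz)
  open import Data.List using ([]; _∷_; map; filter; cartesianProduct; _++_)
  open import Data.List.Relation.Unary.All using (All; []; _∷_)
  open import Data.List.Relation.Unary.AllPairs using (_∷_)
  open import Data.List.Relation.Unary.Any using (here; there)
  open import Data.List.Membership.Propositional using (_∈_)
  open import Data.Sum using ([_,_]′)
  open import Relation.Nullary using (Dec; yes; no; ¬_)
  open import Relation.Nullary.Decidable using (_×-dec_; ¬?)
  open import Function using (_∘_)
  open import Relation.Unary using (Pred; Decidable)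
  open import Relation.Binary using (DecidableEquality)
  open import Relation.Binary.PropositionalEquality

  ∑ : {A : Set} → List A → (A → ℕ) → ℕ
  ∑ [] f = 0
  ∑ (x ∷ xs) f = f x + ∑ xs f

  𝟙 : {P : Set} → Dec P → ℕ
  𝟙 (yes _) = 1
  𝟙 (no _) = 0

  𝟙≤1 : {P : Set} (d : Dec P) → 𝟙 d ≤ 1
  𝟙≤1 (yes _) = ≤-refl
  𝟙≤1 (no _) = z≤n

  𝟙≡1 : {P : Set} (d : Dec P) → P → 𝟙 d ≡ 1
  𝟙≡1 (yes _) _ = refl
  𝟙≡1 (no ¬p) p = ⊥-elim (¬p p)

  𝟙-cong : {P Q : Set} (d : Dec P) (d' : Dec Q) → (P → Q) → (Q → P) → 𝟙 d ≡ 𝟙 d'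
  𝟙-cong (yes p) (yes q) f g = refl
  𝟙-cong (yes p) (no ¬q) f g = ⊥-elim (¬q (f p))
  𝟙-cong (no ¬p) (yes q) f g = ⊥-elim (¬p (g q))
  𝟙-cong (no _) (no _) f g = refl

  𝟙-×-dec : {P Q : Set} (d : Dec P) (d' : Dec Q) → 𝟙 d * 𝟙 d' ≡ 𝟙 (d ×-dec d')
  𝟙-×-dec (yes _) (yes _) = refl
  𝟙-×-dec (yes _) (no _) = refl
  𝟙-×-dec (no _) (yes _) = refl
  𝟙-×-dec (no _) (no _) = refl

  module _ {A : Set} where

    ∑-cong : (xs : List A) {f g : A → ℕ} → (∀ x → f x ≡ g x) → ∑ xs f ≡ ∑ xs g
    ∑-cong [] e = refl
    ∑-cong (x ∷ xs) e = cong₂ _+_ (e x) (∑-cong xs e)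

    ∑-mono-∈ : (xs : List A) {f g : A → ℕ} → (∀ {x} → x ∈ xs → f x ≤ g x) → ∑ xs f ≤ ∑ xs g
    ∑-mono-∈ [] le = z≤n
    ∑-mono-∈ (x ∷ xs) le = +-mono-≤ (le (here refl)) (∑-mono-∈ xs (λ m → le (there m)))

    ∑-mono : (xs : List A) {f g : A → ℕ} → (∀ x → f x ≤ g x) → ∑ xs f ≤ ∑ xs g
    ∑-mono xs le = ∑-mono-∈ xs (λ {x} _ → le x)

    ∑-+ : (xs : List A) (f g : A → ℕ) → ∑ xs (λ x → f x + g x) ≡ ∑ xs f + ∑ xs g
    ∑-+ [] f g = refl
    ∑-+ (x ∷ xs) f g = trans (cong (f x + g x +_) (∑-+ xs f g)) (interchange (f x) (g x) (∑ xs f) (∑ xs g))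

    ∑-*ˡ : (xs : List A) (c : ℕ) (f : A → ℕ) → ∑ xs (λ x → c * f x) ≡ c * ∑ xs f
    ∑-*ˡ [] c f = sym (*-zeroʳ c)
    ∑-*ˡ (x ∷ xs) c f = trans (cong (c * f x +_) (∑-*ˡ xs c f)) (sym (*-distribˡ-+ c (f x) (∑ xs f)))

    ∑-*ʳ : (xs : List A) (c : ℕ) (f : A → ℕ) → ∑ xs (λ x → f x * c) ≡ ∑ xs f * c
    ∑-*ʳ [] c f = refl
    ∑-*ʳ (x ∷ xs) c f = trans (cong (f x * c +_) (∑-*ʳ xs c f)) (sym (*-distribʳ-+ c (f x) (∑ xs f)))

    ∑-*ˡ-square : (xs : List A) (c : ℕ) (f : A → ℕ) → ∑ xs (λ x → (c * f x) * (c * f x)) ≡ (c * c) * ∑ xs (λ x → f x * f x)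
    ∑-*ˡ-square xs c f = trans (∑-cong xs (λ x → [cx][cy]≡[cc][xy] c (f x) (f x))) (∑-*ˡ xs (c * c) _)
      where
      [cx][cy]≡[cc][xy] : ∀ c x y → (c * x) * (c * y) ≡ (c * c) * (x * y)
      [cx][cy]≡[cc][xy] = solve-∀

    ∑-const : (xs : List A) (c : ℕ) → ∑ xs (λ _ → c) ≡ length xs * c
    ∑-const [] c = refl
    ∑-const (x ∷ xs) c = cong (c +_) (∑-const xs c)

    ∑-≤-length : (xs : List A) (f : A → ℕ) → (∀ x → f x ≤ 1) → ∑ xs f ≤ length xs
    ∑-≤-length xs f f≤1 = ≤-trans (∑-mono xs f≤1) (≤-reflexive (trans (∑-const xs 1) (*-identityʳ _)))

    ∑-++ : (xs ys : List A) (f : A → ℕ) → ∑ (xs ++ ys) f ≡ ∑ xs f + ∑ ys f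
    ∑-++ [] ys f = refl
    ∑-++ (x ∷ xs) ys f = trans (cong (f x +_) (∑-++ xs ys f)) (sym (+-assoc (f x) _ _))

    term≤∑ : (xs : List A) (f : A → ℕ) {x : A} → x ∈ xs → f x ≤ ∑ xs f
    term≤∑ (x ∷ xs) f (here refl) = m≤m+n (f x) _
    term≤∑ (x ∷ xs) f (there m) = ≤-trans (term≤∑ xs f m) (m≤n+m _ (f x))

    ∑-filter : (xs : List A) {P : Pred A 0ℓ} (P? : Decidable P) (f : A → ℕ) →
      ∑ (filter P? xs) f ≡ ∑ xs (λ x → 𝟙 (P? x) * f x)
    ∑-filter [] P? f = refl
    ∑-filter (x ∷ xs) P? f with P? x
    ... | yes _ = cong₂ _+_ (sym (+-identityʳ (f x))) (∑-filter xs P? f)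
    ... | no _ = ∑-filter xs P? f

    ∑-filter≤ : (xs : List A) {P : Pred A 0ℓ} (P? : Decidable P) (f : A → ℕ) → ∑ (filter P? xs) f ≤ ∑ xs f
    ∑-filter≤ xs P? f = ≤-trans (≤-reflexive (∑-filter xs P? f))
      (∑-mono xs (λ x → ≤-trans (*-monoˡ-≤ (f x) (𝟙≤1 (P? x))) (≤-reflexive (*-identityˡ (f x)))))

    length-filter≡∑𝟙 : (xs : List A) {P : Pred A 0ℓ} (P? : Decidable P) → length (filter P? xs) ≡ ∑ xs (λ x → 𝟙 (P? x))
    length-filter≡∑𝟙 [] P? = refl
    length-filter≡∑𝟙 (x ∷ xs) P? with P? x
    ... | yes _ = cong suc (length-filter≡∑𝟙 xs P?)
    ... | no _ = length-filter≡∑𝟙 xs P?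

    ∑-partition : (xs : List A) {P : Pred A 0ℓ} (P? : Decidable P) (f : A → ℕ) →
      ∑ xs f ≡ ∑ (filter P? xs) f + ∑ (filter (¬? ∘ P?) xs) f
    ∑-partition [] P? f = refl
    ∑-partition (x ∷ xs) P? f with P? x
    ... | yes _ = trans (cong (f x +_) (∑-partition xs P? f)) (sym (+-assoc (f x) _ _))
    ... | no _ = trans (cong (f x +_) (∑-partition xs P? f)) (x∙yz≈y∙xz (f x) (∑ (filter P? xs) f) (∑ (filter (¬? ∘ P?) xs) f))

    ∑𝟙-atMostOne : (xs : List A) → Unique xs → {P : Pred A 0ℓ} (P? : Decidable P) →
      (∀ x y → P x → P y → x ≡ y) → (k : ℕ) → (∀ x → P x → 1 ≤ k) → ∑ xs (λ x → 𝟙 (P? x)) ≤ k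
    ∑𝟙-atMostOne [] _ P? P-unique k k≥1 = z≤n
    ∑𝟙-atMostOne (x ∷ xs) (x∉xs ∷ u) P? P-unique k k≥1 with P? x
    ... | yes px = ≤-trans (≤-reflexive (cong suc (others-vanish xs x∉xs))) (k≥1 x px)
      where
      others-vanish : (ys : List A) → All (λ y → ¬ x ≡ y) ys → ∑ ys (λ y → 𝟙 (P? y)) ≡ 0
      others-vanish [] _ = refl
      others-vanish (y ∷ ys) (x≢y ∷ a) with P? y
      ... | yes py = ⊥-elim (x≢y (P-unique x y px py))
      ... | no _ = others-vanish ys a
    ... | no _ = ∑𝟙-atMostOne xs u P? P-unique k k≥1

  ∑-map : {A B : Set} (xs : List A) (g : A → B) (f : B → ℕ) → ∑ (map g xs) f ≡ ∑ xs (λ x → f (g x))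
  ∑-map [] g f = refl
  ∑-map (x ∷ xs) g f = cong (f (g x) +_) (∑-map xs g f)

  module _ {A B : Set} where

    ∑-comm : (xs : List A) (ys : List B) (f : A → B → ℕ) →
      ∑ xs (λ x → ∑ ys (λ y → f x y)) ≡ ∑ ys (λ y → ∑ xs (λ x → f x y))
    ∑-comm [] ys f = sym (trans (∑-const ys 0) (*-zeroʳ (length ys)))
    ∑-comm (x ∷ xs) ys f = trans (cong (∑ ys (f x) +_) (∑-comm xs ys f)) (sym (∑-+ ys (f x) (λ y → ∑ xs (λ x' → f x' y))))

    ∑-cartesianProduct : (xs : List A) (ys : List B) (f : A × B → ℕ) →
      ∑ (cartesianProduct xs ys) f ≡ ∑ xs (λ x → ∑ ys (λ y → f (x , y)))
    ∑-cartesianProduct [] ys f = refl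
    ∑-cartesianProduct (x ∷ xs) ys f = trans (∑-++ (map (x ,_) ys) (cartesianProduct xs ys) f)
      (cong₂ _+_ (∑-map ys (x ,_) f) (∑-cartesianProduct xs ys f))

    ∑-*-∑ : (xs : List A) (ys : List B) (f : A → ℕ) (g : B → ℕ) →
      ∑ xs (λ x → ∑ ys (λ y → f x * g y)) ≡ ∑ xs f * ∑ ys g
    ∑-*-∑ xs ys f g = trans (∑-cong xs (λ x → ∑-*ˡ ys (f x) g)) (∑-*ʳ xs (∑ ys g) f)

  module _ {A : Set} (_≟_ : DecidableEquality A) where

    ∑𝟙≟≤1 : (xs : List A) → Unique xs → (p : A) → ∑ xs (λ x → 𝟙 (x ≟ p)) ≤ 1
    ∑𝟙≟≤1 xs u p = ∑𝟙-atMostOne xs u (_≟ p) (λ { x y refl refl → refl }) 1 (λ _ _ → ≤-refl)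

    ∑-δ : (xs : List A) → Unique xs → {p : A} → p ∈ xs → (f : A → ℕ) →
      ∑ xs (λ x → 𝟙 (x ≟ p) * f x) ≡ f p
    ∑-δ xs u {p} p∈xs f = ≤-antisym upper lower
      where
      upper : ∑ xs (λ x → 𝟙 (x ≟ p) * f x) ≤ f p
      upper = begin
        ∑ xs (λ x → 𝟙 (x ≟ p) * f x) ≡⟨ ∑-cong xs only-p ⟩
        ∑ xs (λ x → 𝟙 (x ≟ p) * f p) ≡⟨ ∑-*ʳ xs (f p) _ ⟩
        ∑ xs (λ x → 𝟙 (x ≟ p)) * f p ≤⟨ *-monoˡ-≤ (f p) (∑𝟙≟≤1 xs u p) ⟩
        1 * f p                      ≡⟨ *-identityˡ (f p) ⟩
        f p                          ∎
        where
        open ≤-Reasoning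
        only-p : ∀ x → 𝟙 (x ≟ p) * f x ≡ 𝟙 (x ≟ p) * f p
        only-p x with x ≟ p
        ... | yes refl = refl
        ... | no _ = refl
      lower : f p ≤ ∑ xs (λ x → 𝟙 (x ≟ p) * f x)
      lower = ≤-trans (≤-reflexive (sym (trans (cong (_* f p) (𝟙≡1 (p ≟ p) refl)) (*-identityˡ (f p)))))
                      (term≤∑ xs (λ x → 𝟙 (x ≟ p) * f x) p∈xs)

    ∑-∘-injective : {B : Set} (xs : List B) → Unique xs → (ys : List A) → Unique ys → (g : B → A) →
      (∀ b → g b ∈ ys) → (∀ b b' → g b ≡ g b' → b ≡ b') → (h : A → ℕ) →
      ∑ xs (λ b → h (g b)) ≤ ∑ ys h
    ∑-∘-injective xs ux ys uy g g∈ys g-inj h = begin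
        ∑ xs (λ b → h (g b))                              ≡⟨ ∑-cong xs (λ b → sym (∑-δ ys uy (g∈ys b) h)) ⟩
        ∑ xs (λ b → ∑ ys (λ a → 𝟙 (a ≟ g b) * h a))       ≡⟨ ∑-comm xs ys _ ⟩
        ∑ ys (λ a → ∑ xs (λ b → 𝟙 (a ≟ g b) * h a))       ≡⟨ ∑-cong ys (λ a → ∑-*ʳ xs (h a) (λ b → 𝟙 (a ≟ g b))) ⟩
        ∑ ys (λ a → ∑ xs (λ b → 𝟙 (a ≟ g b)) * h a)       ≤⟨ ∑-mono ys (λ a → *-monoˡ-≤ (h a) (fibre≤1 a)) ⟩
        ∑ ys (λ a → 1 * h a)                              ≡⟨ ∑-cong ys (λ a → *-identityˡ (h a)) ⟩
        ∑ ys h                                            ∎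
      where
      open ≤-Reasoning
      fibre≤1 : ∀ a → ∑ xs (λ b → 𝟙 (a ≟ g b)) ≤ 1
      fibre≤1 a = ∑𝟙-atMostOne xs ux (λ b → a ≟ g b) (λ b b' e e' → g-inj b b' (trans (sym e) e')) 1 (λ _ _ → ≤-refl)

  2xy≤x²+y² : ∀ x y → 2 * (x * y) ≤ x * x + y * y
  2xy≤x²+y² x y = [ ordered , (λ y≤x → subst₂ _≤_ (cong (2 *_) (*-comm y x)) (+-comm (y * y) (x * x)) (ordered y≤x)) ]′ (≤-total x y)
    where
    square-gap : ∀ x d → 2 * (x * (x + d)) + d * d ≡ x * x + (x + d) * (x + d)
    square-gap = solve-∀
    ordered : ∀ {x y} → x ≤ y → 2 * (x * y) ≤ x * x + y * y
    ordered {x} {y} x≤y = subst (λ y → 2 * (x * y) ≤ x * x + y * y) (m+[n∸m]≡n x≤y)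
      (≤-trans (m≤m+n _ ((y ∸ x) * (y ∸ x))) (≤-reflexive (square-gap x (y ∸ x))))

  module _ {A : Set} where

    cauchy-schwarz : (xs : List A) (g : A → ℕ) → ∑ xs g * ∑ xs g ≤ length xs * ∑ xs (λ x → g x * g x)
    cauchy-schwarz xs g = *-cancelˡ-≤ 2 (begin
        2 * (∑ xs g * ∑ xs g)                                ≡⟨ cong (2 *_) (sym (∑-*-∑ xs xs g g)) ⟩
        2 * ∑ xs (λ x → ∑ xs (λ y → g x * g y))              ≡⟨ sym (trans (∑-cong xs (λ x → ∑-*ˡ xs 2 _)) (∑-*ˡ xs 2 _)) ⟩
        ∑ xs (λ x → ∑ xs (λ y → 2 * (g x * g y)))            ≤⟨ ∑-mono xs (λ x → ∑-mono xs (λ y → 2xy≤x²+y² (g x) (g y))) ⟩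
        ∑ xs (λ x → ∑ xs (λ y → g x * g x + g y * g y))      ≡⟨ ∑-cong xs (λ x → ∑-+ xs _ _) ⟩
        ∑ xs (λ x → ∑ xs (λ y → g x * g x) + ∑ xs g²)        ≡⟨ ∑-+ xs _ _ ⟩
        ∑ xs (λ x → ∑ xs (λ y → g x * g x)) + ∑ xs (λ _ → ∑ xs g²)
                                                             ≡⟨ cong₂ _+_ (trans (∑-cong xs (λ x → ∑-const xs _)) (∑-*ˡ xs (length xs) g²))
                                                                          (∑-const xs (∑ xs g²)) ⟩
        length xs * ∑ xs g² + length xs * ∑ xs g²            ≡⟨ cong (length xs * ∑ xs g² +_) (sym (+-identityʳ _)) ⟩
        2 * (length xs * ∑ xs g²)                            ∎)
      where
      open ≤-Reasoning
      g² : A → ℕ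
      g² x = g x * g x

    ∑-square-between : (xs : List A) (f : A → ℕ) {a k : ℕ} →
      (∀ {x} → x ∈ xs → a ≤ f x) → (∀ {x} → x ∈ xs → f x ≤ k) →
      ∑ xs (λ x → f x * f x) + length xs * (k * a) ≤ (a + k) * ∑ xs f
    ∑-square-between xs f {a} {k} a≤f f≤k = begin
        ∑ xs (λ x → f x * f x) + length xs * (k * a) ≡⟨ cong (_ +_) (sym (∑-const xs (k * a))) ⟩
        ∑ xs (λ x → f x * f x) + ∑ xs (λ _ → k * a)  ≡⟨ sym (∑-+ xs _ _) ⟩
        ∑ xs (λ x → f x * f x + k * a)               ≤⟨ ∑-mono-∈ xs (λ x∈xs → square-between (a≤f x∈xs) (f≤k x∈xs)) ⟩
        ∑ xs (λ x → (a + k) * f x)                   ≡⟨ ∑-*ˡ xs (a + k) f ⟩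
        (a + k) * ∑ xs f                             ∎
      where
      open ≤-Reasoning
      -- the slack is (m - a) (k - m)
      expanded : ∀ a d e → (a + d) * (a + d) + (a + d + e) * a + d * e ≡ (a + (a + d + e)) * (a + d)
      expanded = solve-∀
      square-between : ∀ {m} → a ≤ m → m ≤ k → m * m + k * a ≤ (a + k) * m
      square-between {m} a≤m m≤k = subst₂ (λ m k → m * m + k * a ≤ (a + k) * m)
        (m+[n∸m]≡n a≤m) (trans (cong (_+ (k ∸ m)) (m+[n∸m]≡n a≤m)) (m+[n∸m]≡n m≤k))
        (≤-trans (m≤m+n _ ((m ∸ a) * (k ∸ m))) (≤-reflexive (expanded a (m ∸ a) (k ∸ m))))

  module _ {A B : Set} (_≟_ : DecidableEquality B) (range : List B) (range-unique : Unique range) (∈-range : ∀ b → b ∈ range) where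

    collisions-≥ : (xs : List A) (f : A → B) →
      length xs * length xs ≤ length range * ∑ xs (λ x → ∑ xs (λ y → 𝟙 (f x ≟ f y)))
    collisions-≥ xs f = begin
        length xs * length xs         ≡⟨ cong₂ _*_ size size ⟩
        ∑ range fibre * ∑ range fibre ≤⟨ cauchy-schwarz range fibre ⟩
        length range * ∑ range (λ b → fibre b * fibre b)
                                      ≡⟨ cong (length range *_) (sym collisions) ⟩
        length range * ∑ xs (λ x → ∑ xs (λ y → 𝟙 (f x ≟ f y))) ∎
      where
      open ≤-Reasoning
      fibre : B → ℕ
      fibre b = ∑ xs (λ x → 𝟙 (b ≟ f x))
      size : length xs ≡ ∑ range fibre
      size = begin-equality
        length xs                                      ≡⟨ sym (trans (∑-const xs 1) (*-identityʳ _)) ⟩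
        ∑ xs (λ _ → 1)                                 ≡⟨ ∑-cong xs (λ x → sym (∑-δ _≟_ range range-unique (∈-range (f x)) (λ _ → 1))) ⟩
        ∑ xs (λ x → ∑ range (λ b → 𝟙 (b ≟ f x) * 1))   ≡⟨ ∑-comm xs range _ ⟩
        ∑ range (λ b → ∑ xs (λ x → 𝟙 (b ≟ f x) * 1))   ≡⟨ ∑-cong range (λ b → ∑-cong xs (λ x → *-identityʳ _)) ⟩
        ∑ range fibre                                  ∎
      collisions : ∑ xs (λ x → ∑ xs (λ y → 𝟙 (f x ≟ f y))) ≡ ∑ range (λ b → fibre b * fibre b)
      collisions = begin-equality
        ∑ xs (λ x → ∑ xs (λ y → 𝟙 (f x ≟ f y)))
          ≡⟨ ∑-cong xs (λ x → ∑-cong xs (λ y → sym (∑-δ _≟_ range range-unique (∈-range (f x)) (λ b → 𝟙 (b ≟ f y))))) ⟩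
        ∑ xs (λ x → ∑ xs (λ y → ∑ range (λ b → 𝟙 (b ≟ f x) * 𝟙 (b ≟ f y))))
          ≡⟨ trans (∑-cong xs (λ x → ∑-comm xs range _)) (∑-comm xs range _) ⟩
        ∑ range (λ b → ∑ xs (λ x → ∑ xs (λ y → 𝟙 (b ≟ f x) * 𝟙 (b ≟ f y))))
          ≡⟨ ∑-cong range (λ b → ∑-*-∑ xs xs _ _) ⟩
        ∑ range (λ b → fibre b * fibre b) ∎

module Plane {q : ℕ} (F : FiniteField q) where
  open FiniteSum
  import Data.Nat.Properties as ℕ
  open import Data.List using (cartesianProduct; allFin)
  open import Data.List.Properties using (length-map; length-tabulate)
  open import Data.List.Membership.Propositional using (_∈_)
  open import Data.List.Membership.Propositional.Properties using (∈-cartesianProduct⁺)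
  open import Data.List.Relation.Unary.Unique.Propositional.Properties using (map⁺; allFin⁺; cartesianProduct⁺)
  open import Data.Product using (proj₁; proj₂)
  open import Data.Sum using (_⊎_; inj₁; inj₂)
  open import Data.Empty using (⊥-elim)
  open import Relation.Nullary using (¬_; yes; no)
  open import Relation.Binary.PropositionalEquality
  open import Algebra.Bundles using (CommutativeRing)
  open import Function.Bundles using (Inverse)
  import Algebra.Solver.Ring.NaturalCoefficients.Default as NaturalCoefficients
  open FiniteField F

  commutativeRing : CommutativeRing _ _
  commutativeRing = record { isCommutativeRing = isCommutativeRing }

  open CommutativeRing commutativeRing using (*-assoc; *-comm; *-identityʳ; zeroʳ; zeroˡ; +-group; +-abelianGroup; +-commutativeSemigroup; ring; commutativeSemiring)
  open import Algebra.Properties.Ring ring using (x[y-z]≈xy-xz)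
  open import Algebra.Properties.Group +-group using (x∙y⁻¹≈ε⇒x≈y; x≈y⇒x∙y⁻¹≈ε; ∙-cancelʳ; ∙-cancelˡ; ⁻¹-injective)
  open import Algebra.Properties.AbelianGroup +-abelianGroup using (⁻¹-∙-comm)
  open import Algebra.Properties.CommutativeSemigroup +-commutativeSemigroup using (interchange)
  open NaturalCoefficients commutativeSemiring using (solve; _:*_; _:=_)

  -≡0⇒≡ : ∀ {x y} → x - y ≡ 0# → x ≡ y
  -≡0⇒≡ = x∙y⁻¹≈ε⇒x≈y _ _

  ≡⇒-≡0 : ∀ {x y} → x ≡ y → x - y ≡ 0#
  ≡⇒-≡0 = x≈y⇒x∙y⁻¹≈ε

  [a-b]-[c-d] : ∀ a b c d → (a - b) - (c - d) ≡ (a - c) - (b - d)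
  [a-b]-[c-d] a b c d = begin
      (a - b) + - (c + - d)       ≡⟨ cong ((a - b) +_) (sym (⁻¹-∙-comm c (- d))) ⟩
      (a - b) + (- c + - - d)     ≡⟨ interchange a (- b) (- c) (- - d) ⟩
      (a - c) + (- b + - - d)     ≡⟨ cong ((a - c) +_) (⁻¹-∙-comm b (- d)) ⟩
      (a - c) + - (b + - d)       ∎
    where open ≡-Reasoning

  *-cancelʳ : ∀ {y l m} → ¬ y ≡ 0# → l * y ≡ m * y → l ≡ m
  *-cancelʳ {y} {l} {m} y≢0 ly≡my with inverse y y≢0
  ... | y⁻¹ , yy⁻¹≡1 = begin
      l               ≡⟨ sym (*-identityʳ l) ⟩
      l * 1#          ≡⟨ cong (l *_) (sym yy⁻¹≡1) ⟩
      l * (y * y⁻¹)   ≡⟨ sym (*-assoc l y y⁻¹) ⟩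
      (l * y) * y⁻¹   ≡⟨ cong (_* y⁻¹) ly≡my ⟩
      (m * y) * y⁻¹   ≡⟨ *-assoc m y y⁻¹ ⟩
      m * (y * y⁻¹)   ≡⟨ cong (m *_) yy⁻¹≡1 ⟩
      m * 1#          ≡⟨ *-identityʳ m ⟩
      m               ∎
    where open ≡-Reasoning

  proportional : ∀ {a b c d} → ¬ a ≡ 0# → a * d ≡ b * c → Σ Carrier λ m → c ≡ m * a × d ≡ m * b
  proportional {a} {b} {c} {d} a≢0 ad≡bc with inverse a a≢0
  ... | a⁻¹ , aa⁻¹≡1 = c * a⁻¹ , c≡ , d≡
    where
    open ≡-Reasoning
    c≡ : c ≡ (c * a⁻¹) * a
    c≡ = begin
      c                 ≡⟨ sym (*-identityʳ c) ⟩
      c * 1#            ≡⟨ cong (c *_) (sym aa⁻¹≡1) ⟩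
      c * (a * a⁻¹)     ≡⟨ solve 3 (λ A B C → C :* (A :* B) := (C :* B) :* A) refl a a⁻¹ c ⟩
      (c * a⁻¹) * a     ∎
    d≡ : d ≡ (c * a⁻¹) * b
    d≡ = begin
      d                 ≡⟨ sym (*-identityʳ d) ⟩
      d * 1#            ≡⟨ cong (d *_) (sym aa⁻¹≡1) ⟩
      d * (a * a⁻¹)     ≡⟨ solve 3 (λ A B D → D :* (A :* B) := (A :* D) :* B) refl a a⁻¹ d ⟩
      (a * d) * a⁻¹     ≡⟨ cong (_* a⁻¹) ad≡bc ⟩
      (b * c) * a⁻¹     ≡⟨ solve 3 (λ B C I → (B :* C) :* I := (C :* I) :* B) refl b c a⁻¹ ⟩
      (c * a⁻¹) * b     ∎

  *≡0⇒≡0 : ∀ {m z} → ¬ m ≡ 0# → m * z ≡ 0# → z ≡ 0#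
  *≡0⇒≡0 {m} {z} m≢0 mz≡0 = *-cancelʳ m≢0 (trans (*-comm z m) (trans mz≡0 (sym (zeroˡ m))))

  0P : Point
  0P = (0# , 0#)

  det : Point → Point → Carrier
  det (x₁ , x₂) (y₁ , y₂) = x₁ * y₂ - x₂ * y₁

  ⊖≡0P⇒≡ : ∀ {u v} → u ⊖ v ≡ 0P → u ≡ v
  ⊖≡0P⇒≡ e = cong₂ _,_ (-≡0⇒≡ (cong proj₁ e)) (-≡0⇒≡ (cong proj₂ e))

  ⊖-cancelʳ : ∀ {a a' c} → a ⊖ c ≡ a' ⊖ c → a ≡ a'
  ⊖-cancelʳ {_ , _} {_ , _} {c₁ , c₂} e = cong₂ _,_ (∙-cancelʳ (- c₁) _ _ (cong proj₁ e)) (∙-cancelʳ (- c₂) _ _ (cong proj₂ e))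

  ⊖-cancelˡ : ∀ {a c c'} → a ⊖ c ≡ a ⊖ c' → c ≡ c'
  ⊖-cancelˡ {a₁ , a₂} {_ , _} {_ , _} e =
    cong₂ _,_ (⁻¹-injective (∙-cancelˡ a₁ _ _ (cong proj₁ e))) (⁻¹-injective (∙-cancelˡ a₂ _ _ (cong proj₂ e)))

  ·-zeroˡ : ∀ y → 0# · y ≡ 0P
  ·-zeroˡ (y₁ , y₂) = cong₂ _,_ (zeroˡ y₁) (zeroˡ y₂)

  ·-zeroʳ : ∀ l → l · 0P ≡ 0P
  ·-zeroʳ l = cong₂ _,_ (zeroʳ l) (zeroʳ l)

  nonzero-coordinate : ∀ {y₁ y₂} → ¬ (y₁ , y₂) ≡ 0P → (¬ y₁ ≡ 0#) ⊎ (¬ y₂ ≡ 0#)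
  nonzero-coordinate {y₁} {y₂} y≢0 with y₁ ≟ 0# | y₂ ≟ 0#
  ... | no y₁≢0 | _ = inj₁ y₁≢0
  ... | yes _ | no y₂≢0 = inj₂ y₂≢0
  ... | yes refl | yes refl = ⊥-elim (y≢0 refl)

  ·-cancelʳ : ∀ {y l m} → ¬ y ≡ 0P → l · y ≡ m · y → l ≡ m
  ·-cancelʳ {y₁ , y₂} y≢0 e with nonzero-coordinate y≢0
  ... | inj₁ y₁≢0 = *-cancelʳ y₁≢0 (cong proj₁ e)
  ... | inj₂ y₂≢0 = *-cancelʳ y₂≢0 (cong proj₂ e)

  ·-nonzero : ∀ {m y} → ¬ m ≡ 0# → ¬ y ≡ 0P → ¬ m · y ≡ 0P
  ·-nonzero {m} {y₁ , y₂} m≢0 y≢0 e = y≢0 (cong₂ _,_ (*≡0⇒≡0 m≢0 (cong proj₁ e)) (*≡0⇒≡0 m≢0 (cong proj₂ e)))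

  l[b-d]-rearrange : ∀ l a b c d → (a - c) - l * (b - d) ≡ (a - l * b) - (c - l * d)
  l[b-d]-rearrange l a b c d = trans (cong (λ z → (a - c) - z) (x[y-z]≈xy-xz l b d)) ([a-b]-[c-d] a c (l * b) (l * d))

  ⊖≡·⊖⇒ : ∀ l a b c d → a ⊖ c ≡ l · (b ⊖ d) → a ⊖ (l · b) ≡ c ⊖ (l · d)
  ⊖≡·⊖⇒ l (a₁ , a₂) (b₁ , b₂) (c₁ , c₂) (d₁ , d₂) e =
    cong₂ _,_ (-≡0⇒≡ (trans (sym (l[b-d]-rearrange l a₁ b₁ c₁ d₁)) (≡⇒-≡0 (cong proj₁ e))))
              (-≡0⇒≡ (trans (sym (l[b-d]-rearrange l a₂ b₂ c₂ d₂)) (≡⇒-≡0 (cong proj₂ e))))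

  ⊖≡·⊖⇐ : ∀ l a b c d → a ⊖ (l · b) ≡ c ⊖ (l · d) → a ⊖ c ≡ l · (b ⊖ d)
  ⊖≡·⊖⇐ l (a₁ , a₂) (b₁ , b₂) (c₁ , c₂) (d₁ , d₂) e =
    cong₂ _,_ (-≡0⇒≡ (trans (l[b-d]-rearrange l a₁ b₁ c₁ d₁) (≡⇒-≡0 (cong proj₁ e))))
              (-≡0⇒≡ (trans (l[b-d]-rearrange l a₂ b₂ c₂ d₂) (≡⇒-≡0 (cong proj₂ e))))

  det-self : ∀ y → det y y ≡ 0#
  det-self (y₁ , y₂) = ≡⇒-≡0 (*-comm y₁ y₂)

  det-0Pˡ : ∀ w → det 0P w ≡ 0#
  det-0Pˡ (w₁ , w₂) = trans (cong₂ _-_ (zeroˡ w₂) (zeroˡ w₁)) (≡⇒-≡0 refl)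

  det-·-selfʳ : ∀ y l → det y (l · y) ≡ 0#
  det-·-selfʳ (y₁ , y₂) l = ≡⇒-≡0 (solve 3 (λ a b c → a :* (c :* b) := b :* (c :* a)) refl y₁ y₂ l)

  det-·ˡ : ∀ m y w → det (m · y) w ≡ m * det y w
  det-·ˡ m (y₁ , y₂) (w₁ , w₂) = begin
      (m * y₁) * w₂ - (m * y₂) * w₁ ≡⟨ cong₂ _-_ (*-assoc m y₁ w₂) (*-assoc m y₂ w₁) ⟩
      m * (y₁ * w₂) - m * (y₂ * w₁) ≡⟨ sym (x[y-z]≈xy-xz m _ _) ⟩
      m * (y₁ * w₂ - y₂ * w₁)       ∎
    where open ≡-Reasoning

  det-⊖ʳ : ∀ y a c → det y (a ⊖ c) ≡ det y a - det y c
  det-⊖ʳ (y₁ , y₂) (a₁ , a₂) (c₁ , c₂) = begin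
      y₁ * (a₂ - c₂) - y₂ * (a₁ - c₁)           ≡⟨ cong₂ _-_ (x[y-z]≈xy-xz y₁ a₂ c₂) (x[y-z]≈xy-xz y₂ a₁ c₁) ⟩
      (y₁ * a₂ - y₁ * c₂) - (y₂ * a₁ - y₂ * c₁) ≡⟨ [a-b]-[c-d] _ _ _ _ ⟩
      (y₁ * a₂ - y₂ * a₁) - (y₁ * c₂ - y₂ * c₁) ∎
    where open ≡-Reasoning

  det-⊖≡0⇒ : ∀ y a c → det y (a ⊖ c) ≡ 0# → det y a ≡ det y c
  det-⊖≡0⇒ y a c e = -≡0⇒≡ (trans (sym (det-⊖ʳ y a c)) e)

  det-⊖≡0⇐ : ∀ y a c → det y a ≡ det y c → det y (a ⊖ c) ≡ 0#
  det-⊖≡0⇐ y a c e = trans (det-⊖ʳ y a c) (≡⇒-≡0 e)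

  det≡0-sym : ∀ w y → det w y ≡ 0# → det y w ≡ 0#
  det≡0-sym (w₁ , w₂) (y₁ , y₂) e = ≡⇒-≡0 (trans (*-comm y₁ w₂) (trans (sym (-≡0⇒≡ e)) (*-comm w₁ y₂)))

  det-·ˡ≡0⇒ : ∀ {m} y w → ¬ m ≡ 0# → det (m · y) w ≡ 0# → det y w ≡ 0#
  det-·ˡ≡0⇒ {m} y w m≢0 e = *≡0⇒≡0 m≢0 (trans (sym (det-·ˡ m y w)) e)

  det-·ˡ≡0⇐ : ∀ m y w → det y w ≡ 0# → det (m · y) w ≡ 0#
  det-·ˡ≡0⇐ m y w e = trans (det-·ˡ m y w) (trans (cong (m *_) e) (zeroʳ m))

  det≡0⇒multiple : ∀ y w → ¬ y ≡ 0P → det y w ≡ 0# → Σ Carrier λ m → w ≡ m · y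
  det≡0⇒multiple (y₁ , y₂) (w₁ , w₂) y≢0 e with nonzero-coordinate y≢0
  ... | inj₁ y₁≢0 = let (m , w₁≡ , w₂≡) = proportional y₁≢0 (-≡0⇒≡ e) in m , cong₂ _,_ w₁≡ w₂≡
  ... | inj₂ y₂≢0 = let (m , w₂≡ , w₁≡) = proportional y₂≢0 (sym (-≡0⇒≡ e)) in m , cong₂ _,_ w₁≡ w₂≡

  elements-unique : Unique elements
  elements-unique = map⁺ to-injective (allFin⁺ q)
    where
    to-injective : ∀ {x y} → Inverse.to enum x ≡ Inverse.to enum y → x ≡ y
    to-injective {x} {y} e = trans (sym (Inverse.strictlyInverseʳ enum x))
      (trans (cong (Inverse.from enum) e) (Inverse.strictlyInverseʳ enum y))

  length-elements : length elements ≡ q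
  length-elements = trans (length-map (Inverse.to enum) (allFin q)) (length-tabulate _)

  points : List Point
  points = cartesianProduct elements elements

  ∈-points : ∀ x → x ∈ points
  ∈-points (a , b) = ∈-cartesianProduct⁺ (∈-elements a) (∈-elements b)

  points-unique : Unique points
  points-unique = cartesianProduct⁺ elements-unique elements-unique

  length-points : length points ≡ q ℕ.* q
  length-points = begin
      length points                                 ≡⟨ sym (trans (∑-const points 1) (ℕ.*-identityʳ _)) ⟩
      ∑ points (λ _ → 1)                            ≡⟨ ∑-cartesianProduct elements elements _ ⟩
      ∑ elements (λ _ → ∑ elements (λ _ → 1))       ≡⟨ ∑-cong elements (λ _ → trans (∑-const elements 1) (ℕ.*-identityʳ _)) ⟩
      ∑ elements (λ _ → length elements)            ≡⟨ ∑-const elements _ ⟩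
      length elements ℕ.* length elements           ≡⟨ cong₂ ℕ._*_ length-elements length-elements ⟩
      q ℕ.* q                                       ∎
    where open ≡-Reasoning

  0<q : 0 ℕ.< q
  0<q = ℕ.≤-trans (ℕ.≤-reflexive (sym (𝟙≡1 (0# ≟ 0#) refl)))
    (ℕ.≤-trans (term≤∑ elements (λ x → 𝟙 (x ≟ 0#)) (∈-elements 0#))
      (ℕ.≤-trans (∑-≤-length elements _ (λ x → 𝟙≤1 (x ≟ 0#))) (ℕ.≤-reflexive length-elements)))

module Incidences {q : ℕ} (F : FiniteField q) (E : List (FiniteField.Point F)) (E-unique : Unique E) where
  open FiniteSum
  open import Data.Nat as ℕ using (ℕ; z≤n; _≤_)
  open import Data.Nat.Properties as ℕ hiding (_≟_)
  open import Data.List using (cartesianProduct; filter)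
  open import Data.List.Properties using (length-filter)
  open import Data.List.Membership.Propositional using (_∈_)
  open import Data.List.Membership.Propositional.Properties using (∈-filter⁻)
  open import Data.Product using (proj₁; proj₂)
  open import Data.Sum using (_⊎_; inj₁; inj₂; [_,_]′)
  open import Data.Empty using (⊥-elim)
  open import Function using (_∘_)
  open import Relation.Nullary using (¬_; Dec; yes; no)
  open import Relation.Nullary.Decidable using (_×-dec_; ¬?)
  open import Relation.Binary.PropositionalEquality
  open FiniteField F
  open Plane F

  n : ℕ
  n = length E

  Pair Quadruple : Set
  Pair = Point × Point
  Quadruple = Pair × Pair

  E² : List Pair
  E² = cartesianProduct E E

  E⁴ : List Quadruple
  E⁴ = cartesianProduct E² E²

  diff : Pair → Point
  diff (u , v) = u ⊖ v

  diagonal? : (w : Pair) → Dec (proj₁ w ≡ proj₂ w)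
  diagonal? (u , v) = u ≟P v

  solves? : (l : Carrier) (p : Quadruple) → Dec (diff (proj₁ p) ≡ l · diff (proj₂ p))
  solves? l (w , w') = diff w ≟P (l · diff w')

  N : Carrier → ℕ
  N l = ∑ E⁴ (λ p → 𝟙 (solves? l p))

  energy mass : ℕ
  energy = ∑ elements (λ l → N l ℕ.* N l)
  mass = ∑ elements N

  ∑-E : ∑ E (λ _ → 1) ≡ n
  ∑-E = trans (∑-const E 1) (*-identityʳ n)

  ∑-E² : ∑ E² (λ _ → 1) ≡ n ℕ.* n
  ∑-E² = trans (∑-cartesianProduct E E _) (trans (∑-cong E (λ _ → ∑-E)) (∑-const E n))

  ∑-E²-E² : (g : Pair → Pair → ℕ) →
    ∑ E² (λ w → ∑ E² (λ w' → g w w')) ≡ ∑ E (λ a → ∑ E (λ b → ∑ E (λ c → ∑ E (λ d → g (a , b) (c , d)))))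
  ∑-E²-E² g = trans (∑-cartesianProduct E E _) (∑-cong E (λ a → ∑-cong E (λ b → ∑-cartesianProduct E E _)))

  ∑-E⁴ : (f : Quadruple → ℕ) → ∑ E⁴ f ≡ ∑ E (λ a → ∑ E (λ b → ∑ E (λ c → ∑ E (λ d → f ((a , b) , (c , d))))))
  ∑-E⁴ f = trans (∑-cartesianProduct E² E² f) (∑-E²-E² (λ w w' → f (w , w')))

  diagonal-count : ∑ E² (λ w → 𝟙 (diagonal? w)) ≤ n
  diagonal-count = begin
      ∑ E² (λ w → 𝟙 (diagonal? w))      ≡⟨ ∑-cartesianProduct E E _ ⟩
      ∑ E (λ u → ∑ E (λ v → 𝟙 (u ≟P v))) ≡⟨ ∑-comm E E _ ⟩
      ∑ E (λ v → ∑ E (λ u → 𝟙 (u ≟P v))) ≤⟨ ∑-mono E (∑𝟙≟≤1 _≟P_ E E-unique) ⟩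
      ∑ E (λ _ → 1)                      ≡⟨ ∑-E ⟩
      n                                  ∎
    where open ≤-Reasoning

  L²-as-sum : L² E ≡ ∑ E⁴ (λ p → ∑ E⁴ (λ p' → 𝟙 (Cond? (p , p'))))
  L²-as-sum = trans (length-filter≡∑𝟙 (cartesianProduct E⁴ E⁴) Cond?) (∑-cartesianProduct E⁴ E⁴ _)

  energy-as-sum : ∑ E⁴ (λ p → ∑ E⁴ (λ p' → ∑ elements (λ l → 𝟙 (solves? l p) ℕ.* 𝟙 (solves? l p')))) ≡ energy
  energy-as-sum = trans (∑-cong E⁴ (λ p → ∑-comm E⁴ elements _))
    (trans (∑-comm E⁴ elements _) (∑-cong elements (λ l → ∑-*-∑ E⁴ E⁴ _ _)))

  L²≤energy : L² E ≤ energy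
  L²≤energy = begin
      L² E                                                   ≡⟨ L²-as-sum ⟩
      ∑ E⁴ (λ p → ∑ E⁴ (λ p' → 𝟙 (Cond? (p , p'))))          ≤⟨ ∑-mono E⁴ (λ p → ∑-mono E⁴ (λ p' → witness-counted p p')) ⟩
      ∑ E⁴ (λ p → ∑ E⁴ (λ p' → ∑ elements (λ l → 𝟙 (solves? l p) ℕ.* 𝟙 (solves? l p')))) ≡⟨ energy-as-sum ⟩
      energy                                                 ∎
    where
    open ≤-Reasoning
    witness-counted : ∀ p p' → 𝟙 (Cond? (p , p')) ≤ ∑ elements (λ l → 𝟙 (solves? l p) ℕ.* 𝟙 (solves? l p'))
    witness-counted p p' with Cond? (p , p')
    ... | no _ = z≤n
    ... | yes (l , _ , e , e') = ≤-trans (≤-reflexive (sym (cong₂ ℕ._*_ (𝟙≡1 (solves? l p) e) (𝟙≡1 (solves? l p') e'))))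
                                         (term≤∑ elements (λ l → 𝟙 (solves? l p) ℕ.* 𝟙 (solves? l p')) (∈-elements l))

  Degenerate : Quadruple → Set
  Degenerate (w , w') = proj₁ w ≡ proj₂ w × proj₁ w' ≡ proj₂ w'

  degenerate? : (p : Quadruple) → Dec (Degenerate p)
  degenerate? (w , w') = diagonal? w ×-dec diagonal? w'

  ratio-unique : ∀ p {l l'} → ¬ Degenerate p → diff (proj₁ p) ≡ l · diff (proj₂ p) → diff (proj₁ p) ≡ l' · diff (proj₂ p) → l ≡ l'
  ratio-unique (w , w') {l} p-nondeg e e' with diff w' ≟P 0P
  ... | no y≢0 = ·-cancelʳ y≢0 (trans (sym e) e')
  ... | yes y≡0 = ⊥-elim (p-nondeg (⊖≡0P⇒≡ (trans e (trans (cong (l ·_) y≡0) (·-zeroʳ l))) , ⊖≡0P⇒≡ y≡0))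

  -- a common ratio 0 forces u₁ = v₁ in both quadruples; otherwise it witnesses Cond
  at-most-one-ratio : ∀ p p' → ¬ Degenerate p ⊎ ¬ Degenerate p' →
    ∑ elements (λ l → 𝟙 (solves? l p) ℕ.* 𝟙 (solves? l p')) ≤ 𝟙 (Cond? (p , p')) ℕ.+ 𝟙 (diagonal? (proj₁ p)) ℕ.* 𝟙 (diagonal? (proj₁ p'))
  at-most-one-ratio p p' nondeg = ≤-trans (≤-reflexive (∑-cong elements (λ l → 𝟙-×-dec (solves? l p) (solves? l p'))))
      (∑𝟙-atMostOne elements elements-unique (λ l → solves? l p ×-dec solves? l p') unique _ counted)
    where
    unique : ∀ l l' → _ → _ → l ≡ l'
    unique l l' (e₁ , e₂) (e₁' , e₂') = [ (λ nd → ratio-unique p nd e₁ e₁') , (λ nd → ratio-unique p' nd e₂ e₂') ]′ nondeg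
    zero-ratio : ∀ p → diff (proj₁ p) ≡ 0# · diff (proj₂ p) → proj₁ (proj₁ p) ≡ proj₂ (proj₁ p)
    zero-ratio p e = ⊖≡0P⇒≡ (trans e (·-zeroˡ (diff (proj₂ p))))
    counted : ∀ l → _ → 1 ≤ 𝟙 (Cond? (p , p')) ℕ.+ 𝟙 (diagonal? (proj₁ p)) ℕ.* 𝟙 (diagonal? (proj₁ p'))
    counted l (e , e') with l ≟ 0#
    ... | yes refl = ≤-trans (≤-reflexive (sym (cong₂ ℕ._*_ (𝟙≡1 (diagonal? (proj₁ p)) (zero-ratio p e))
                                                           (𝟙≡1 (diagonal? (proj₁ p')) (zero-ratio p' e')))))
                             (m≤n+m _ _)
    ... | no l≢0 = ≤-trans (≤-reflexive (sym (𝟙≡1 (Cond? (p , p')) (l , l≢0 , e , e')))) (m≤m+n _ _)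

  common-ratios≤ : ∀ p p' → ∑ elements (λ l → 𝟙 (solves? l p) ℕ.* 𝟙 (solves? l p'))
    ≤ 𝟙 (Cond? (p , p')) ℕ.+ 𝟙 (diagonal? (proj₁ p)) ℕ.* 𝟙 (diagonal? (proj₁ p')) ℕ.+ q ℕ.* (𝟙 (degenerate? p) ℕ.* 𝟙 (degenerate? p'))
  common-ratios≤ p p' with degenerate? p | degenerate? p'
  ... | yes _ | yes _ = ≤-trans (∑-≤-length elements _ (λ l → *-mono-≤ (𝟙≤1 (solves? l p)) (𝟙≤1 (solves? l p'))))
                                (≤-trans (≤-reflexive (trans length-elements (sym (*-identityʳ q)))) (m≤n+m _ _))
  ... | no p-nondeg | _ = ≤-trans (at-most-one-ratio p p' (inj₁ p-nondeg)) (m≤m+n _ _)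
  ... | yes _ | no p'-nondeg = ≤-trans (at-most-one-ratio p p' (inj₂ p'-nondeg)) (m≤m+n _ _)

  first-diagonal-count : ∑ E⁴ (λ p → 𝟙 (diagonal? (proj₁ p))) ≤ n ℕ.* (n ℕ.* n)
  first-diagonal-count = begin
      ∑ E⁴ (λ p → 𝟙 (diagonal? (proj₁ p)))                      ≡⟨ ∑-cartesianProduct E² E² _ ⟩
      ∑ E² (λ w → ∑ E² (λ w' → 𝟙 (diagonal? w)))                ≡⟨ ∑-cong E² (λ w → ∑-cong E² (λ w' → sym (*-identityʳ _))) ⟩
      ∑ E² (λ w → ∑ E² (λ w' → 𝟙 (diagonal? w) ℕ.* 1))          ≡⟨ ∑-*-∑ E² E² _ _ ⟩
      ∑ E² (λ w → 𝟙 (diagonal? w)) ℕ.* ∑ E² (λ _ → 1)           ≤⟨ *-mono-≤ diagonal-count (≤-reflexive ∑-E²) ⟩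
      n ℕ.* (n ℕ.* n)                                            ∎
    where open ≤-Reasoning

  degenerate-count : ∑ E⁴ (λ p → 𝟙 (degenerate? p)) ≤ n ℕ.* n
  degenerate-count = begin
      ∑ E⁴ (λ p → 𝟙 (degenerate? p))                            ≡⟨ ∑-cartesianProduct E² E² _ ⟩
      ∑ E² (λ w → ∑ E² (λ w' → 𝟙 (degenerate? (w , w'))))       ≡⟨ ∑-cong E² (λ w → ∑-cong E² (λ w' → sym (𝟙-×-dec (diagonal? w) (diagonal? w')))) ⟩
      ∑ E² (λ w → ∑ E² (λ w' → 𝟙 (diagonal? w) ℕ.* 𝟙 (diagonal? w'))) ≡⟨ ∑-*-∑ E² E² _ _ ⟩
      ∑ E² (λ w → 𝟙 (diagonal? w)) ℕ.* ∑ E² (λ w → 𝟙 (diagonal? w)) ≤⟨ *-mono-≤ diagonal-count diagonal-count ⟩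
      n ℕ.* n                                                    ∎
    where open ≤-Reasoning

  energy≤ : energy ≤ L² E ℕ.+ (n ℕ.* (n ℕ.* n)) ℕ.* (n ℕ.* (n ℕ.* n)) ℕ.+ q ℕ.* ((n ℕ.* n) ℕ.* (n ℕ.* n))
  energy≤ = begin
      energy ≡⟨ sym energy-as-sum ⟩
      ∑ E⁴ (λ p → ∑ E⁴ (λ p' → ∑ elements (λ l → 𝟙 (solves? l p) ℕ.* 𝟙 (solves? l p'))))
        ≤⟨ ∑-mono E⁴ (λ p → ∑-mono E⁴ (common-ratios≤ p)) ⟩
      ∑ E⁴ (λ p → ∑ E⁴ (λ p' → 𝟙 (Cond? (p , p')) ℕ.+ diag₁ p ℕ.* diag₁ p' ℕ.+ q ℕ.* (deg p ℕ.* deg p')))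
        ≡⟨ ∑-cong E⁴ (λ p → trans (∑-+ E⁴ _ _) (cong₂ ℕ._+_ (∑-+ E⁴ _ _) (∑-*ˡ E⁴ q _))) ⟩
      ∑ E⁴ (λ p → ∑ E⁴ (λ p' → 𝟙 (Cond? (p , p'))) ℕ.+ ∑ E⁴ (λ p' → diag₁ p ℕ.* diag₁ p') ℕ.+ q ℕ.* ∑ E⁴ (λ p' → deg p ℕ.* deg p'))
        ≡⟨ trans (∑-+ E⁴ _ _) (cong₂ ℕ._+_ (∑-+ E⁴ _ _) (∑-*ˡ E⁴ q _)) ⟩
      ∑ E⁴ (λ p → ∑ E⁴ (λ p' → 𝟙 (Cond? (p , p')))) ℕ.+ ∑ E⁴ (λ p → ∑ E⁴ (λ p' → diag₁ p ℕ.* diag₁ p'))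
        ℕ.+ q ℕ.* ∑ E⁴ (λ p → ∑ E⁴ (λ p' → deg p ℕ.* deg p'))
        ≡⟨ cong₂ ℕ._+_ (cong₂ ℕ._+_ (sym L²-as-sum) (∑-*-∑ E⁴ E⁴ diag₁ diag₁)) (cong (q ℕ.*_) (∑-*-∑ E⁴ E⁴ deg deg)) ⟩
      L² E ℕ.+ ∑ E⁴ diag₁ ℕ.* ∑ E⁴ diag₁ ℕ.+ q ℕ.* (∑ E⁴ deg ℕ.* ∑ E⁴ deg)
        ≤⟨ +-mono-≤ (+-monoʳ-≤ (L² E) (*-mono-≤ first-diagonal-count first-diagonal-count))
                    (*-monoʳ-≤ q (*-mono-≤ degenerate-count degenerate-count)) ⟩
      L² E ℕ.+ (n ℕ.* (n ℕ.* n)) ℕ.* (n ℕ.* (n ℕ.* n)) ℕ.+ q ℕ.* ((n ℕ.* n) ℕ.* (n ℕ.* n)) ∎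
    where
    open ≤-Reasoning
    diag₁ deg : Quadruple → ℕ
    diag₁ p = 𝟙 (diagonal? (proj₁ p))
    deg p = 𝟙 (degenerate? p)

  n≤q² : n ≤ q ℕ.* q
  n≤q² = begin
      n                     ≡⟨ sym ∑-E ⟩
      ∑ E (λ _ → 1)         ≤⟨ ∑-∘-injective _≟P_ E E-unique points points-unique (λ x → x) ∈-points (λ _ _ e → e) (λ _ → 1) ⟩
      ∑ points (λ _ → 1)    ≡⟨ trans (∑-const points 1) (trans (*-identityʳ _) length-points) ⟩
      q ℕ.* q               ∎
    where open ≤-Reasoning

  length-E² : length E² ≡ n ℕ.* n
  length-E² = trans (sym (trans (∑-const E² 1) (*-identityʳ _))) ∑-E²

  -- N l counts collisions of (u, v) ↦ u - l v on E², which are hence at least |E²|² / |F_q²|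
  n⁴≤q²N : ∀ l → (n ℕ.* n) ℕ.* (n ℕ.* n) ≤ (q ℕ.* q) ℕ.* N l
  n⁴≤q²N l = begin
      (n ℕ.* n) ℕ.* (n ℕ.* n)                                         ≡⟨ sym (cong₂ ℕ._*_ length-E² length-E²) ⟩
      length E² ℕ.* length E²                                         ≤⟨ collisions-≥ _≟P_ points points-unique ∈-points E² f ⟩
      length points ℕ.* ∑ E² (λ w → ∑ E² (λ w' → 𝟙 (f w ≟P f w')))     ≡⟨ cong₂ ℕ._*_ length-points collisions≡N ⟩
      (q ℕ.* q) ℕ.* N l                                               ∎
    where
    open ≤-Reasoning
    f : Pair → Point
    f (u , v) = u ⊖ (l · v)
    collisions≡N : ∑ E² (λ w → ∑ E² (λ w' → 𝟙 (f w ≟P f w'))) ≡ N l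
    collisions≡N = begin-equality
      ∑ E² (λ w → ∑ E² (λ w' → 𝟙 (f w ≟P f w')))
        ≡⟨ ∑-E²-E² _ ⟩
      ∑ E (λ u₁ → ∑ E (λ u₂ → ∑ E (λ v₁ → ∑ E (λ v₂ → 𝟙 (f (u₁ , u₂) ≟P f (v₁ , v₂))))))
        ≡⟨ ∑-cong E (λ u₁ → ∑-comm E E _) ⟩
      ∑ E (λ u₁ → ∑ E (λ v₁ → ∑ E (λ u₂ → ∑ E (λ v₂ → 𝟙 (f (u₁ , u₂) ≟P f (v₁ , v₂))))))
        ≡⟨ ∑-cong E (λ u₁ → ∑-cong E (λ v₁ → ∑-cong E (λ u₂ → ∑-cong E (λ v₂ →
             𝟙-cong (f (u₁ , u₂) ≟P f (v₁ , v₂)) (solves? l ((u₁ , v₁) , (u₂ , v₂)))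
                    (⊖≡·⊖⇐ l u₁ u₂ v₁ v₂) (⊖≡·⊖⇒ l u₁ u₂ v₁ v₂))))) ⟩
      ∑ E (λ u₁ → ∑ E (λ v₁ → ∑ E (λ u₂ → ∑ E (λ v₂ → 𝟙 (solves? l ((u₁ , v₁) , (u₂ , v₂)))))))
        ≡⟨ sym (∑-E⁴ _) ⟩
      N l ∎

  N≤n³ : ∀ l → N l ≤ n ℕ.* (n ℕ.* n)
  N≤n³ l = begin
      N l ≡⟨ ∑-E⁴ _ ⟩
      ∑ E (λ u₁ → ∑ E (λ v₁ → ∑ E (λ u₂ → ∑ E (λ v₂ → I ((u₁ , v₁) , (u₂ , v₂))))))
        ≡⟨ ∑-comm E E _ ⟩
      ∑ E (λ v₁ → ∑ E (λ u₁ → ∑ E (λ u₂ → ∑ E (λ v₂ → I ((u₁ , v₁) , (u₂ , v₂))))))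
        ≡⟨ ∑-cong E (λ v₁ → trans (∑-comm E E _) (∑-cong E (λ u₂ → ∑-comm E E _))) ⟩
      ∑ E (λ v₁ → ∑ E (λ u₂ → ∑ E (λ v₂ → ∑ E (λ u₁ → I ((u₁ , v₁) , (u₂ , v₂))))))
        ≤⟨ ∑-mono E (λ v₁ → ∑-mono E (λ u₂ → ∑-mono E (λ v₂ → u₁-determined v₁ u₂ v₂))) ⟩
      ∑ E (λ v₁ → ∑ E (λ u₂ → ∑ E (λ v₂ → 1)))
        ≡⟨ ∑-cong E (λ v₁ → trans (∑-cong E (λ u₂ → ∑-E)) (∑-const E n)) ⟩
      ∑ E (λ v₁ → n ℕ.* n) ≡⟨ ∑-const E _ ⟩
      n ℕ.* (n ℕ.* n) ∎
    where
    open ≤-Reasoning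
    I : Quadruple → ℕ
    I p = 𝟙 (solves? l p)
    u₁-determined : ∀ v₁ u₂ v₂ → ∑ E (λ u₁ → I ((u₁ , v₁) , (u₂ , v₂))) ≤ 1
    u₁-determined v₁ u₂ v₂ = ∑𝟙-atMostOne E E-unique (λ u₁ → solves? l ((u₁ , v₁) , (u₂ , v₂)))
      (λ _ _ e e' → ⊖-cancelʳ (trans e (sym e'))) 1 (λ _ _ → ≤-refl)

  pairsAlong : Point → ℕ
  pairsAlong y = ∑ E² (λ w → 𝟙 (det y (diff w) ≟ 0#))

  pairsAlong≤n² : ∀ y → pairsAlong y ≤ n ℕ.* n
  pairsAlong≤n² y = ≤-trans (∑-mono E² (λ w → 𝟙≤1 (det y (diff w) ≟ 0#))) (≤-reflexive ∑-E²)

  pairsAlong-0P : pairsAlong 0P ≡ n ℕ.* n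
  pairsAlong-0P = trans (∑-cong E² (λ w → 𝟙≡1 (det 0P (diff w) ≟ 0#) (det-0Pˡ _))) ∑-E²

  pairsAlong-· : ∀ {m} y → ¬ m ≡ 0# → pairsAlong (m · y) ≡ pairsAlong y
  pairsAlong-· {m} y m≢0 = ∑-cong E² (λ w →
    𝟙-cong (det (m · y) (diff w) ≟ 0#) (det y (diff w) ≟ 0#) (det-·ˡ≡0⇒ y _ m≢0) (det-·ˡ≡0⇐ m y _))

  -- the pairs along y are the collisions of det y, which takes at most q values
  n²≤q*pairsAlong : ∀ y → n ℕ.* n ≤ q ℕ.* pairsAlong y
  n²≤q*pairsAlong y = begin
      n ℕ.* n                                                  ≤⟨ collisions-≥ _≟_ elements elements-unique ∈-elements E (det y) ⟩
      length elements ℕ.* ∑ E (λ a → ∑ E (λ c → 𝟙 (det y a ≟ det y c)))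
        ≡⟨ cong₂ ℕ._*_ length-elements (∑-cong E (λ a → ∑-cong E (λ c →
             𝟙-cong (det y a ≟ det y c) (det y (a ⊖ c) ≟ 0#) (det-⊖≡0⇐ y a c) (det-⊖≡0⇒ y a c)))) ⟩
      q ℕ.* ∑ E (λ a → ∑ E (λ c → 𝟙 (det y (a ⊖ c) ≟ 0#)))     ≡⟨ cong (q ℕ.*_) (sym (∑-cartesianProduct E E _)) ⟩
      q ℕ.* pairsAlong y                                        ∎
    where open ≤-Reasoning

  on-line≤q : {A : Set} (xs : List A) → Unique xs → (h : A → Point) → (∀ {x x'} → h x ≡ h x' → x ≡ x') →
    ∀ {y} → ¬ y ≡ 0P → ∑ xs (λ x → 𝟙 (det y (h x) ≟ 0#)) ≤ q
  on-line≤q xs xs-unique h h-injective {y} y≢0 = begin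
      ∑ xs (λ x → 𝟙 (det y (h x) ≟ 0#))                    ≤⟨ ∑-mono xs multiple-of-y ⟩
      ∑ xs (λ x → ∑ elements (λ m → 𝟙 (h x ≟P (m · y))))   ≡⟨ ∑-comm xs elements _ ⟩
      ∑ elements (λ m → ∑ xs (λ x → 𝟙 (h x ≟P (m · y))))   ≤⟨ ∑-mono elements hit-once ⟩
      ∑ elements (λ _ → 1)                                 ≡⟨ trans (∑-const elements 1) (trans (*-identityʳ _) length-elements) ⟩
      q                                                    ∎
    where
    open ≤-Reasoning
    multiple-of-y : ∀ x → 𝟙 (det y (h x) ≟ 0#) ≤ ∑ elements (λ m → 𝟙 (h x ≟P (m · y)))
    multiple-of-y x with det y (h x) ≟ 0#
    ... | no _ = z≤n
    ... | yes e with det≡0⇒multiple y (h x) y≢0 e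
    ... | m , hx≡my = ≤-trans (≤-reflexive (sym (𝟙≡1 (h x ≟P (m · y)) hx≡my)))
                              (term≤∑ elements (λ m → 𝟙 (h x ≟P (m · y))) (∈-elements m))
    hit-once : ∀ m → ∑ xs (λ x → 𝟙 (h x ≟P (m · y))) ≤ 1
    hit-once m = ∑𝟙-atMostOne xs xs-unique (λ x → h x ≟P (m · y)) (λ _ _ e e' → h-injective (trans e (sym e'))) 1 (λ _ _ → ≤-refl)

  pairsAlong≤nq : ∀ {y} → ¬ y ≡ 0P → pairsAlong y ≤ n ℕ.* q
  pairsAlong≤nq {y} y≢0 = begin
      pairsAlong y                                        ≡⟨ ∑-cartesianProduct E E _ ⟩
      ∑ E (λ a → ∑ E (λ c → 𝟙 (det y (a ⊖ c) ≟ 0#)))       ≤⟨ ∑-mono E (λ a → on-line≤q E E-unique (a ⊖_) ⊖-cancelˡ y≢0) ⟩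
      ∑ E (λ _ → q)                                       ≡⟨ ∑-const E q ⟩
      n ℕ.* q                                             ∎
    where open ≤-Reasoning

  nonzeroPoints : List Point
  nonzeroPoints = filter (¬? ∘ (_≟P 0P)) points

  ∑-points : ∀ f → ∑ points f ≡ ∑ nonzeroPoints f ℕ.+ f 0P
  ∑-points f = begin
      ∑ points f                                                      ≡⟨ ∑-partition points (_≟P 0P) f ⟩
      ∑ (filter (_≟P 0P) points) f ℕ.+ ∑ nonzeroPoints f              ≡⟨ cong (ℕ._+ ∑ nonzeroPoints f) (∑-filter points (_≟P 0P) f) ⟩
      ∑ points (λ x → 𝟙 (x ≟P 0P) ℕ.* f x) ℕ.+ ∑ nonzeroPoints f      ≡⟨ cong (ℕ._+ ∑ nonzeroPoints f) (∑-δ _≟P_ points points-unique (∈-points 0P) f) ⟩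
      f 0P ℕ.+ ∑ nonzeroPoints f                                      ≡⟨ +-comm (f 0P) _ ⟩
      ∑ nonzeroPoints f ℕ.+ f 0P                                      ∎
    where open ≡-Reasoning

  length-nonzeroPoints : length nonzeroPoints ℕ.+ 1 ≡ q ℕ.* q
  length-nonzeroPoints = begin
      length nonzeroPoints ℕ.+ 1          ≡⟨ cong (ℕ._+ 1) (sym (trans (∑-const nonzeroPoints 1) (*-identityʳ _))) ⟩
      ∑ nonzeroPoints (λ _ → 1) ℕ.+ 1     ≡⟨ sym (∑-points (λ _ → 1)) ⟩
      ∑ points (λ _ → 1)                  ≡⟨ trans (∑-const points 1) (*-identityʳ _) ⟩
      length points                       ≡⟨ length-points ⟩
      q ℕ.* q                             ∎
    where open ≡-Reasoning

  lineSum lineEnergy : ℕ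
  lineSum = ∑ nonzeroPoints pairsAlong
  lineEnergy = ∑ nonzeroPoints (λ x → pairsAlong x ℕ.* pairsAlong x)

  -- swap the sums: a nonzero difference a - b is parallel to the q points of its line, the zero one to all q²
  lineSum≤ : lineSum ℕ.+ n ℕ.* n ≤ n ℕ.* (q ℕ.* q) ℕ.+ (n ℕ.* n) ℕ.* q
  lineSum≤ = begin
      lineSum ℕ.+ n ℕ.* n                                       ≡⟨ cong (lineSum ℕ.+_) (sym pairsAlong-0P) ⟩
      lineSum ℕ.+ pairsAlong 0P                                 ≡⟨ sym (∑-points pairsAlong) ⟩
      ∑ points pairsAlong                                       ≡⟨ ∑-comm points E² _ ⟩
      ∑ E² (λ w → ∑ points (λ x → 𝟙 (det x (diff w) ≟ 0#)))     ≤⟨ ∑-mono E² points-along ⟩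
      ∑ E² (λ w → 𝟙 (diagonal? w) ℕ.* (q ℕ.* q) ℕ.+ q)          ≡⟨ trans (∑-+ E² _ _) (cong₂ ℕ._+_ (∑-*ʳ E² _ _) (∑-const E² q)) ⟩
      ∑ E² (λ w → 𝟙 (diagonal? w)) ℕ.* (q ℕ.* q) ℕ.+ length E² ℕ.* q
                                                                ≤⟨ +-mono-≤ (*-monoˡ-≤ (q ℕ.* q) diagonal-count) (≤-reflexive (cong (ℕ._* q) length-E²)) ⟩
      n ℕ.* (q ℕ.* q) ℕ.+ (n ℕ.* n) ℕ.* q                       ∎
    where
    open ≤-Reasoning
    points-along : ∀ w → ∑ points (λ x → 𝟙 (det x (diff w) ≟ 0#)) ≤ 𝟙 (diagonal? w) ℕ.* (q ℕ.* q) ℕ.+ q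
    points-along (u , v) with u ≟P v
    ... | yes _ = ≤-trans (∑-≤-length points _ (λ x → 𝟙≤1 (det x (u ⊖ v) ≟ 0#)))
                          (≤-trans (≤-reflexive (trans length-points (sym (*-identityˡ _)))) (m≤m+n _ q))
    ... | no u≢v = ≤-trans (∑-mono points swap-det) (on-line≤q points points-unique (λ x → x) (λ e → e) (λ e → u≢v (⊖≡0P⇒≡ e)))
      where
      swap-det : ∀ x → 𝟙 (det x (u ⊖ v) ≟ 0#) ≤ 𝟙 (det (u ⊖ v) x ≟ 0#)
      swap-det x = ≤-reflexive (𝟙-cong (det x (u ⊖ v) ≟ 0#) (det (u ⊖ v) x ≟ 0#) (det≡0-sym x (u ⊖ v)) (det≡0-sym (u ⊖ v) x))

  -- pairsAlong is constant on the q - 1 nonzero multiples of y, all of which lie along y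
  q*pairsAlong≤ : ∀ {y} → ¬ y ≡ 0P → q ℕ.* pairsAlong y ≤ pairsAlong y ℕ.+ ∑ nonzeroPoints (λ x → 𝟙 (det x y ≟ 0#) ℕ.* pairsAlong x)
  q*pairsAlong≤ {y} y≢0 = begin
      q ℕ.* pairsAlong y                                        ≡⟨ sym (trans (∑-const elements _) (cong (ℕ._* pairsAlong y) length-elements)) ⟩
      ∑ elements (λ _ → pairsAlong y)                           ≤⟨ ∑-mono elements zero-or-multiple ⟩
      ∑ elements (λ m → 𝟙 (m ≟ 0#) ℕ.* pairsAlong y ℕ.+ h (m · y))
                                                                ≡⟨ trans (∑-+ elements _ _) (cong (ℕ._+ ∑ elements (λ m → h (m · y))) (∑-*ʳ elements _ _)) ⟩
      ∑ elements (λ m → 𝟙 (m ≟ 0#)) ℕ.* pairsAlong y ℕ.+ ∑ elements (λ m → h (m · y))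
        ≤⟨ +-mono-≤ (≤-trans (*-monoˡ-≤ (pairsAlong y) (∑𝟙≟≤1 _≟_ elements elements-unique 0#)) (≤-reflexive (*-identityˡ _)))
                    (∑-∘-injective _≟P_ elements elements-unique points points-unique (_· y) (λ _ → ∈-points _) (λ _ _ → ·-cancelʳ y≢0) h) ⟩
      pairsAlong y ℕ.+ ∑ points h                               ≡⟨ cong (pairsAlong y ℕ.+_) (sym (∑-filter points (¬? ∘ (_≟P 0P)) _)) ⟩
      pairsAlong y ℕ.+ ∑ nonzeroPoints (λ x → 𝟙 (det x y ≟ 0#) ℕ.* pairsAlong x) ∎
    where
    open ≤-Reasoning
    h : Point → ℕ
    h x = 𝟙 (¬? (x ≟P 0P)) ℕ.* (𝟙 (det x y ≟ 0#) ℕ.* pairsAlong x)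
    zero-or-multiple : ∀ m → pairsAlong y ≤ 𝟙 (m ≟ 0#) ℕ.* pairsAlong y ℕ.+ h (m · y)
    zero-or-multiple m with m ≟ 0#
    ... | yes _ = ≤-trans (≤-reflexive (sym (*-identityˡ _))) (m≤m+n _ _)
    ... | no m≢0 = ≤-reflexive (sym (begin-equality
        h (m · y)                                     ≡⟨ cong₂ ℕ._*_ (𝟙≡1 (¬? ((m · y) ≟P 0P)) (·-nonzero m≢0 y≢0))
                                                               (cong₂ ℕ._*_ (𝟙≡1 (det (m · y) y ≟ 0#) (det-·ˡ≡0⇐ m y y (det-self y))) (pairsAlong-· y m≢0)) ⟩
        1 ℕ.* (1 ℕ.* pairsAlong y)                    ≡⟨ trans (*-identityˡ _) (*-identityˡ _) ⟩
        pairsAlong y                                  ∎))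

  offDiagonal : List Pair
  offDiagonal = filter (¬? ∘ diagonal?) E²

  offDiagonal-diff≢0P : ∀ {w} → w ∈ offDiagonal → ¬ diff w ≡ 0P
  offDiagonal-diff≢0P {u , v} w∈ e = proj₂ (∈-filter⁻ (¬? ∘ diagonal?) {xs = E²} w∈) (⊖≡0P⇒≡ e)

  offDiagonalSum : ℕ
  offDiagonalSum = ∑ offDiagonal (pairsAlong ∘ diff)

  q*offDiagonalSum≤ : q ℕ.* offDiagonalSum ≤ lineEnergy ℕ.+ offDiagonalSum
  q*offDiagonalSum≤ = begin
      q ℕ.* offDiagonalSum                                    ≡⟨ sym (∑-*ˡ offDiagonal q _) ⟩
      ∑ offDiagonal (λ w → q ℕ.* pairsAlong (diff w))         ≤⟨ ∑-mono-∈ offDiagonal (λ w∈ → q*pairsAlong≤ (offDiagonal-diff≢0P w∈)) ⟩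
      ∑ offDiagonal (λ w → pairsAlong (diff w) ℕ.+ along (diff w))
                                                              ≡⟨ trans (∑-+ offDiagonal _ _) (+-comm offDiagonalSum _) ⟩
      ∑ offDiagonal (λ w → along (diff w)) ℕ.+ offDiagonalSum ≤⟨ +-monoˡ-≤ offDiagonalSum (∑-filter≤ E² (¬? ∘ diagonal?) _) ⟩
      ∑ E² (λ w → along (diff w)) ℕ.+ offDiagonalSum          ≡⟨ cong (ℕ._+ offDiagonalSum) regroup ⟩
      lineEnergy ℕ.+ offDiagonalSum                           ∎
    where
    open ≤-Reasoning
    along : Point → ℕ
    along y = ∑ nonzeroPoints (λ x → 𝟙 (det x y ≟ 0#) ℕ.* pairsAlong x)
    regroup : ∑ E² (λ w → along (diff w)) ≡ lineEnergy
    regroup = trans (∑-comm E² nonzeroPoints _) (∑-cong nonzeroPoints (λ x → ∑-*ʳ E² (pairsAlong x) _))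
  offDiagonalSum≤ : offDiagonalSum ≤ (n ℕ.* n) ℕ.* (n ℕ.* q)
  offDiagonalSum≤ = begin
      offDiagonalSum                          ≤⟨ ∑-mono-∈ offDiagonal (λ w∈ → pairsAlong≤nq (offDiagonal-diff≢0P w∈)) ⟩
      ∑ offDiagonal (λ _ → n ℕ.* q)           ≡⟨ ∑-const offDiagonal _ ⟩
      length offDiagonal ℕ.* (n ℕ.* q)        ≤⟨ *-monoˡ-≤ (n ℕ.* q) (≤-trans (length-filter (¬? ∘ diagonal?) E²) (≤-reflexive length-E²)) ⟩
      (n ℕ.* n) ℕ.* (n ℕ.* q)                 ∎
    where open ≤-Reasoning

  ratios≤ : ∀ p → ∑ elements (λ l → 𝟙 (solves? l p)) ≤ q ℕ.* 𝟙 (degenerate? p) ℕ.+ 𝟙 (det (diff (proj₂ p)) (diff (proj₁ p)) ≟ 0#)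
  ratios≤ p with degenerate? p
  ... | yes _ = ≤-trans (∑-≤-length elements _ (λ l → 𝟙≤1 (solves? l p)))
                        (≤-trans (≤-reflexive (trans length-elements (sym (*-identityʳ q)))) (m≤m+n _ _))
  ... | no p-nondeg = ∑𝟙-atMostOne elements elements-unique (λ l → solves? l p) (λ _ _ → ratio-unique p p-nondeg) _
      (λ l e → ≤-trans (≤-reflexive (sym (𝟙≡1 (det (diff (proj₂ p)) (diff (proj₁ p)) ≟ 0#)
                                            (trans (cong (det (diff (proj₂ p))) e) (det-·-selfʳ (diff (proj₂ p)) l)))))
                       (m≤n+m _ _))

  mass≤ : mass ≤ q ℕ.* (n ℕ.* n) ℕ.+ n ℕ.* (n ℕ.* n) ℕ.+ offDiagonalSum
  mass≤ = begin
      mass                                                                    ≡⟨ ∑-comm elements E⁴ _ ⟩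
      ∑ E⁴ (λ p → ∑ elements (λ l → 𝟙 (solves? l p)))                        ≤⟨ ∑-mono E⁴ ratios≤ ⟩
      ∑ E⁴ (λ p → q ℕ.* 𝟙 (degenerate? p) ℕ.+ 𝟙 (det (diff (proj₂ p)) (diff (proj₁ p)) ≟ 0#))
        ≡⟨ trans (∑-+ E⁴ _ _) (cong₂ ℕ._+_ (∑-*ˡ E⁴ q _) (trans (∑-cartesianProduct E² E² _) (∑-comm E² E² _))) ⟩
      q ℕ.* ∑ E⁴ (λ p → 𝟙 (degenerate? p)) ℕ.+ ∑ E² (pairsAlong ∘ diff)      ≤⟨ +-mono-≤ (*-monoʳ-≤ q degenerate-count) ≤-refl ⟩
      q ℕ.* (n ℕ.* n) ℕ.+ ∑ E² (pairsAlong ∘ diff)                           ≡⟨ cong (q ℕ.* (n ℕ.* n) ℕ.+_) (∑-partition E² diagonal? _) ⟩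
      q ℕ.* (n ℕ.* n) ℕ.+ (∑ (filter diagonal? E²) (pairsAlong ∘ diff) ℕ.+ offDiagonalSum)
        ≤⟨ +-monoʳ-≤ (q ℕ.* (n ℕ.* n)) (+-monoˡ-≤ offDiagonalSum diagonal-part) ⟩
      q ℕ.* (n ℕ.* n) ℕ.+ (n ℕ.* (n ℕ.* n) ℕ.+ offDiagonalSum)               ≡⟨ sym (+-assoc (q ℕ.* (n ℕ.* n)) _ offDiagonalSum) ⟩
      q ℕ.* (n ℕ.* n) ℕ.+ n ℕ.* (n ℕ.* n) ℕ.+ offDiagonalSum                 ∎
    where
    open ≤-Reasoning
    diagonal-part : ∑ (filter diagonal? E²) (pairsAlong ∘ diff) ≤ n ℕ.* (n ℕ.* n)
    diagonal-part = begin
      ∑ (filter diagonal? E²) (pairsAlong ∘ diff)  ≤⟨ ∑-mono (filter diagonal? E²) (λ w → pairsAlong≤n² (diff w)) ⟩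
      ∑ (filter diagonal? E²) (λ _ → n ℕ.* n)      ≡⟨ ∑-const (filter diagonal? E²) _ ⟩
      length (filter diagonal? E²) ℕ.* (n ℕ.* n)   ≤⟨ *-monoˡ-≤ (n ℕ.* n) (≤-trans (≤-reflexive (length-filter≡∑𝟙 E² diagonal?)) diagonal-count) ⟩
      n ℕ.* (n ℕ.* n)                              ∎

  lineEnergy-moment : (q ℕ.* q) ℕ.* lineEnergy ℕ.+ length nonzeroPoints ℕ.* ((q ℕ.* (n ℕ.* q)) ℕ.* (n ℕ.* n))
    ≤ (n ℕ.* n ℕ.+ q ℕ.* (n ℕ.* q)) ℕ.* (q ℕ.* lineSum)
  lineEnergy-moment = begin
      (q ℕ.* q) ℕ.* lineEnergy ℕ.+ length nonzeroPoints ℕ.* (k ℕ.* a)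
        ≡⟨ cong (ℕ._+ length nonzeroPoints ℕ.* (k ℕ.* a)) (sym (∑-*ˡ-square nonzeroPoints q pairsAlong)) ⟩
      ∑ nonzeroPoints (λ x → M x ℕ.* M x) ℕ.+ length nonzeroPoints ℕ.* (k ℕ.* a)
        ≤⟨ ∑-square-between nonzeroPoints M (λ {x} _ → n²≤q*pairsAlong x) (λ x∈ → *-monoʳ-≤ q (pairsAlong≤nq (nonzero x∈))) ⟩
      (a ℕ.+ k) ℕ.* ∑ nonzeroPoints M ≡⟨ cong ((a ℕ.+ k) ℕ.*_) (∑-*ˡ nonzeroPoints q pairsAlong) ⟩
      (a ℕ.+ k) ℕ.* (q ℕ.* lineSum) ∎
    where
    open ≤-Reasoning
    a k : ℕ
    a = n ℕ.* n
    k = q ℕ.* (n ℕ.* q)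
    M : Point → ℕ
    M x = q ℕ.* pairsAlong x
    nonzero : ∀ {x} → x ∈ nonzeroPoints → ¬ x ≡ 0P
    nonzero x∈ = proj₂ (∈-filter⁻ (¬? ∘ (_≟P 0P)) {xs = points} x∈)

  energy-moment : (q ℕ.* q) ℕ.* (q ℕ.* q) ℕ.* energy ℕ.+ q ℕ.* (((q ℕ.* q) ℕ.* (n ℕ.* (n ℕ.* n))) ℕ.* ((n ℕ.* n) ℕ.* (n ℕ.* n)))
    ≤ ((n ℕ.* n) ℕ.* (n ℕ.* n) ℕ.+ (q ℕ.* q) ℕ.* (n ℕ.* (n ℕ.* n))) ℕ.* ((q ℕ.* q) ℕ.* mass)
  energy-moment = begin
      (q ℕ.* q) ℕ.* (q ℕ.* q) ℕ.* energy ℕ.+ q ℕ.* (k ℕ.* a)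
        ≡⟨ cong₂ ℕ._+_ (sym (∑-*ˡ-square elements (q ℕ.* q) N)) (cong (ℕ._* (k ℕ.* a)) (sym length-elements)) ⟩
      ∑ elements (λ l → M l ℕ.* M l) ℕ.+ length elements ℕ.* (k ℕ.* a)
        ≤⟨ ∑-square-between elements M (λ {l} _ → n⁴≤q²N l) (λ {l} _ → *-monoʳ-≤ (q ℕ.* q) (N≤n³ l)) ⟩
      (a ℕ.+ k) ℕ.* ∑ elements M ≡⟨ cong ((a ℕ.+ k) ℕ.*_) (∑-*ˡ elements (q ℕ.* q) N) ⟩
      (a ℕ.+ k) ℕ.* ((q ℕ.* q) ℕ.* mass) ∎
    where
    open ≤-Reasoning
    a k : ℕ
    a = (n ℕ.* n) ℕ.* (n ℕ.* n)
    k = (q ℕ.* q) ℕ.* (n ℕ.* (n ℕ.* n))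
    M : Carrier → ℕ
    M l = (q ℕ.* q) ℕ.* N l

  q*n⁸≤q⁴*energy : q ℕ.* (((n ℕ.* n) ℕ.* (n ℕ.* n)) ℕ.* ((n ℕ.* n) ℕ.* (n ℕ.* n))) ≤ (q ℕ.* q) ℕ.* (q ℕ.* q) ℕ.* energy
  q*n⁸≤q⁴*energy = begin
      q ℕ.* (n⁴ ℕ.* n⁴)                                              ≡⟨ sym (trans (∑-const elements _) (cong (ℕ._* (n⁴ ℕ.* n⁴)) length-elements)) ⟩
      ∑ elements (λ _ → n⁴ ℕ.* n⁴)                                   ≤⟨ ∑-mono elements (λ l → *-mono-≤ (n⁴≤q²N l) (n⁴≤q²N l)) ⟩
      ∑ elements (λ l → ((q ℕ.* q) ℕ.* N l) ℕ.* ((q ℕ.* q) ℕ.* N l))  ≡⟨ ∑-*ˡ-square elements (q ℕ.* q) N ⟩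
      (q ℕ.* q) ℕ.* (q ℕ.* q) ℕ.* energy                             ∎
    where
    open ≤-Reasoning
    n⁴ = (n ℕ.* n) ℕ.* (n ℕ.* n)

module Distance where
  open import Data.Nat
  open import Data.Nat.Properties
  open import Data.Sum using (inj₁; inj₂)
  import Data.Integer as ℤ
  import Data.Integer.Properties as ℤ
  open import Relation.Binary.PropositionalEquality

  ∣+x-+y∣≤ : ∀ x y d → x ≤ y + d → y ≤ x + d → ℤ.∣ ℤ.+ x ℤ.- ℤ.+ y ∣ ≤ d
  ∣+x-+y∣≤ x y d x≤y+d y≤x+d with ≤-total x y
  ... | inj₁ x≤y = ≤-trans (≤-reflexive (trans (cong ℤ.∣_∣ (ℤ.m-n≡m⊖n x y)) (ℤ.∣⊖∣-≤ x≤y))) (m≤n+o⇒m∸n≤o y x y≤x+d)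
  ... | inj₂ y≤x = ≤-trans (≤-reflexive (trans (cong ℤ.∣_∣ (ℤ.m-n≡m⊖n x y)) (trans (ℤ.∣m⊖n∣≡∣n⊖m∣ x y) (ℤ.∣⊖∣-≤ y≤x))))
                           (m≤n+o⇒m∸n≤o x y x≤y+d)

module Estimates (n q : ℕ) (0<q : 0 ℕ.< q) (n≤q² : n ℕ.≤ q ℕ.* q) where
  open import Data.Nat
  open import Data.Nat.Properties
  open import Data.Nat.Tactic.RingSolver using (solve-∀)
  open import Data.Nat.Solver using (module +-*-Solver)
  import Data.Integer as ℤ
  open Distance
  open import Relation.Binary.PropositionalEquality

  n² n³ n⁴ q² q³ : ℕ
  n² = n * n
  n³ = n * n²
  n⁴ = n² * n²
  q² = q * q
  q³ = q * q²

  instance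
    q≢0 : NonZero q
    q≢0 = >-nonZero 0<q

    q²≢0 : NonZero q²
    q²≢0 = m*n≢0 q q

  n³≤q³n² : n³ ≤ q³ * n²
  n³≤q³n² = *-monoˡ-≤ n² (≤-trans n≤q² (m≤n*m q² q))

  qn³≤q³n² : q * n³ ≤ q³ * n²
  qn³≤q³n² = ≤-trans (≤-reflexive (q[nn²]≡[qn]n² q n)) (*-monoˡ-≤ n² (*-monoʳ-≤ q n≤q²))
    where
    q[nn²]≡[qn]n² : ∀ q n → q * (n * (n * n)) ≡ (q * n) * (n * n)
    q[nn²]≡[qn]n² = solve-∀

  lineEnergy≤ : ∀ {T U W} →
    q² * T + W * ((q * (n * q)) * n²) ≤ (n² + q * (n * q)) * (q * U) →
    U + n² ≤ n * q² + n² * q →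
    W + 1 ≡ q² →
    T ≤ n⁴ + q³ * n² + n³
  lineEnergy≤ {T} {U} {W} moment sum count = *-cancelˡ-≤ q² (+-cancelʳ-≤ X _ _ (begin
      q² * T + X                                           ≤⟨ m≤m+n _ (q * n⁴) ⟩
      q² * T + X + q * n⁴                                  ≡⟨ regroup q n T ⟩
      q² * T + q² * K + a * (q * n²)                       ≡⟨ cong (λ w → q² * T + w * K + a * (q * n²)) (sym count) ⟩
      q² * T + (W + 1) * K + a * (q * n²)                  ≡⟨ split-off-K q n T W ⟩
      (q² * T + W * K) + (K + a * (q * n²))                ≤⟨ +-monoˡ-≤ _ moment ⟩
      a * (q * U) + (K + a * (q * n²))                     ≡⟨ factor q n U ⟩
      a * q * (U + n²) + K                                 ≤⟨ +-monoˡ-≤ K (*-monoʳ-≤ (a * q) sum) ⟩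
      a * q * (n * q² + n² * q) + K                        ≡⟨ expand q n ⟩
      q² * (n⁴ + q³ * n² + n³) + X                         ∎))
    where
    open ≤-Reasoning
    a K X : ℕ
    a = n² + q * (n * q)
    K = (q * (n * q)) * n²
    X = q² * K + q * K
    regroup : ∀ q n T → q * q * T + (q * q * (q * (n * q) * (n * n)) + q * (q * (n * q) * (n * n))) + q * ((n * n) * (n * n))
                 ≡ q * q * T + q * q * (q * (n * q) * (n * n)) + (n * n + q * (n * q)) * (q * (n * n))
    regroup = solve-∀
    split-off-K : ∀ q n T W → q * q * T + (W + 1) * (q * (n * q) * (n * n)) + (n * n + q * (n * q)) * (q * (n * n))
                   ≡ (q * q * T + W * (q * (n * q) * (n * n))) + (q * (n * q) * (n * n) + (n * n + q * (n * q)) * (q * (n * n)))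
    split-off-K = solve-∀
    factor : ∀ q n U → (n * n + q * (n * q)) * (q * U) + (q * (n * q) * (n * n) + (n * n + q * (n * q)) * (q * (n * n)))
                 ≡ (n * n + q * (n * q)) * q * (U + n * n) + q * (n * q) * (n * n)
    factor = solve-∀
    expand : ∀ q n → (n * n + q * (n * q)) * q * (n * (q * q) + (n * n) * q) + q * (n * q) * (n * n)
               ≡ q * q * ((n * n) * (n * n) + q * (q * q) * (n * n) + n * (n * n)) + (q * q * (q * (n * q) * (n * n)) + q * (q * (n * q) * (n * n)))
    expand = solve-∀

  q*offDiagonalSum≤n⁴+3q³n² : ∀ {T Q} → q * Q ≤ T + Q → Q ≤ n² * (n * q) → T ≤ n⁴ + q³ * n² + n³ → q * Q ≤ n⁴ + 3 * (q³ * n²)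
  q*offDiagonalSum≤n⁴+3q³n² {T} {Q} qQ≤T+Q Q≤ T≤ = begin
      q * Q                                        ≤⟨ qQ≤T+Q ⟩
      T + Q                                        ≤⟨ +-mono-≤ T≤ Q≤ ⟩
      n⁴ + q³ * n² + n³ + n² * (n * q)             ≡⟨ cong (n⁴ + q³ * n² + n³ +_) (n²[nq]≡qn³ n q) ⟩
      n⁴ + q³ * n² + n³ + q * n³                   ≤⟨ +-mono-≤ (+-monoʳ-≤ (n⁴ + q³ * n²) n³≤q³n²) qn³≤q³n² ⟩
      n⁴ + q³ * n² + q³ * n² + q³ * n²             ≡⟨ a+b+b+b≡a+3b n⁴ (q³ * n²) ⟩
      n⁴ + 3 * (q³ * n²)                           ∎
    where
    open ≤-Reasoning
    n²[nq]≡qn³ : ∀ n q → (n * n) * (n * q) ≡ q * (n * (n * n))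
    n²[nq]≡qn³ = solve-∀
    a+b+b+b≡a+3b : ∀ a b → a + b + b + b ≡ a + 3 * b
    a+b+b+b≡a+3b = solve-∀

  q*mass≤n⁴+5q³n² : ∀ {S Q} → S ≤ q * n² + n³ + Q → q * Q ≤ n⁴ + 3 * (q³ * n²) → q * S ≤ n⁴ + 5 * (q³ * n²)
  q*mass≤n⁴+5q³n² {S} {Q} S≤ qQ≤ = begin
      q * S                                        ≤⟨ *-monoʳ-≤ q S≤ ⟩
      q * (q * n² + n³ + Q)                        ≡⟨ *-distribˡ-+ q (q * n² + n³) Q ⟩
      q * (q * n² + n³) + q * Q                    ≤⟨ +-mono-≤ (≤-trans (≤-reflexive (*-distribˡ-+ q (q * n²) n³)) (+-mono-≤ q²n²≤q³n² qn³≤q³n²)) qQ≤ ⟩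
      q³ * n² + q³ * n² + (n⁴ + 3 * (q³ * n²))     ≡⟨ 2b+[a+3b]≡a+5b n⁴ (q³ * n²) ⟩
      n⁴ + 5 * (q³ * n²)                           ∎
    where
    open ≤-Reasoning
    q²n²≤q³n² : q * (q * n²) ≤ q³ * n²
    q²n²≤q³n² = ≤-trans (≤-reflexive (sym (*-assoc q q n²))) (*-monoˡ-≤ n² (*-monoʳ-≤ q (m≤m*n q q)))
    2b+[a+3b]≡a+5b : ∀ a b → b + b + (a + 3 * b) ≡ a + 5 * b
    2b+[a+3b]≡a+5b = solve-∀

  q³energy≤ : ∀ {En S} →
    q² * q² * En + q * ((q² * n³) * n⁴) ≤ (n⁴ + q² * n³) * (q² * S) →
    q * S ≤ n⁴ + 5 * (q³ * n²) →
    q³ * En ≤ n⁴ * n⁴ + 5 * (q³ * (n² * n⁴ + q² * (n * n⁴)))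
  q³energy≤ {En} {S} moment qS≤ = *-cancelˡ-≤ q² (+-cancelʳ-≤ Y _ _ (begin
      q² * (q³ * En) + Y                                      ≡⟨ pull-out-q q n En ⟩
      q * (q² * q² * En + q * ((q² * n³) * n⁴))               ≤⟨ *-monoʳ-≤ q moment ⟩
      q * ((n⁴ + q² * n³) * (q² * S))                         ≡⟨ regroup q n S ⟩
      (n⁴ + q² * n³) * q² * (q * S)                           ≤⟨ *-monoʳ-≤ ((n⁴ + q² * n³) * q²) qS≤ ⟩
      (n⁴ + q² * n³) * q² * (n⁴ + 5 * (q³ * n²))              ≡⟨ expand q n ⟩
      q² * (n⁴ * n⁴ + 5 * (q³ * (n² * n⁴ + q² * (n * n⁴)))) + Y ∎))
    where
    open ≤-Reasoning
    Y : ℕ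
    Y = q * (q * ((q² * n³) * n⁴))
    pull-out-q : ∀ q n E → q * q * (q * (q * q) * E) + q * (q * ((q * q * (n * (n * n))) * ((n * n) * (n * n))))
                 ≡ q * (q * q * (q * q) * E + q * ((q * q * (n * (n * n))) * ((n * n) * (n * n))))
    pull-out-q = solve-∀
    regroup : ∀ q n S → q * (((n * n) * (n * n) + q * q * (n * (n * n))) * (q * q * S))
                 ≡ ((n * n) * (n * n) + q * q * (n * (n * n))) * (q * q) * (q * S)
    regroup = solve-∀
    expand : ∀ q n → ((n * n) * (n * n) + q * q * (n * (n * n))) * (q * q) * ((n * n) * (n * n) + 5 * (q * (q * q) * (n * n)))
               ≡ q * q * ((n * n) * (n * n) * ((n * n) * (n * n)) + 5 * (q * (q * q) * ((n * n) * ((n * n) * (n * n)) + q * q * (n * ((n * n) * (n * n))))))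
                 + q * (q * ((q * q * (n * (n * n))) * ((n * n) * (n * n))))
    expand = solve-∀

  n⁸≤q³energy : ∀ {En} → q * (n⁴ * n⁴) ≤ q² * q² * En → n⁴ * n⁴ ≤ q³ * En
  n⁸≤q³energy {En} le = *-cancelˡ-≤ q (≤-trans le (≤-reflexive (q²q²≡q*q³ q En)))
    where
    q²q²≡q*q³ : ∀ q E → q * q * (q * q) * E ≡ q * (q * (q * q) * E)
    q²q²≡q*q³ = solve-∀

  deviation≤ : ∀ {L En} → L ≤ En → En ≤ L + n³ * n³ + q * n⁴ →
    n⁴ * n⁴ ≤ q³ * En → q³ * En ≤ n⁴ * n⁴ + 5 * (q³ * (n² * n⁴ + q² * (n * n⁴))) →
    ℤ.∣ ℤ.+ (q ^ 3 * L) ℤ.- ℤ.+ (n ^ 8) ∣ ≤ 5 * q ^ 3 * (n ^ 6 + q ^ 2 * n ^ 5)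
  deviation≤ {L} {En} L≤En En≤ lower upper = subst₂ (λ x y → ℤ.∣ ℤ.+ x ℤ.- ℤ.+ y ∣ ≤ 5 * q ^ 3 * (n ^ 6 + q ^ 2 * n ^ 5))
      (cong (_* L) (sym (q^3≡q³ q))) (sym (n^8≡n⁴n⁴ n))
      (subst (ℤ.∣ ℤ.+ (q³ * L) ℤ.- ℤ.+ (n⁴ * n⁴) ∣ ≤_) (sym (error≡ n q))
        (∣+x-+y∣≤ (q³ * L) (n⁴ * n⁴) (5 * (q³ * D)) (≤-trans (*-monoʳ-≤ q³ L≤En) upper) n⁸≤))
    where
    open +-*-Solver
    D : ℕ
    D = n² * n⁴ + q² * (n * n⁴)
    m⁴≤m*m⁴ : ∀ m → (m * m) * (m * m) ≤ m * ((m * m) * (m * m))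
    m⁴≤m*m⁴ zero = z≤n
    m⁴≤m*m⁴ (suc m) = m≤n*m _ (suc m)
    small≤D : n³ * n³ + q * n⁴ ≤ D
    small≤D = +-mono-≤ (≤-reflexive (n³n³≡n²n⁴ n)) (*-mono-≤ (m≤m*n q q) (m⁴≤m*m⁴ n))
      where
      n³n³≡n²n⁴ : ∀ n → n * (n * n) * (n * (n * n)) ≡ n * n * ((n * n) * (n * n))
      n³n³≡n²n⁴ = solve-∀
    n⁸≤ : n⁴ * n⁴ ≤ q³ * L + 5 * (q³ * D)
    n⁸≤ = begin
      n⁴ * n⁴                                   ≤⟨ lower ⟩
      q³ * En                                   ≤⟨ *-monoʳ-≤ q³ En≤ ⟩
      q³ * (L + n³ * n³ + q * n⁴)               ≡⟨ trans (cong (q³ *_) (+-assoc L (n³ * n³) (q * n⁴))) (*-distribˡ-+ q³ L _) ⟩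
      q³ * L + q³ * (n³ * n³ + q * n⁴)          ≤⟨ +-monoʳ-≤ (q³ * L) (≤-trans (*-monoʳ-≤ q³ small≤D) (m≤n*m (q³ * D) 5)) ⟩
      q³ * L + 5 * (q³ * D)                     ∎
      where open ≤-Reasoning
    q^3≡q³ : ∀ q → q ^ 3 ≡ q * (q * q)
    q^3≡q³ = solve 1 (λ q → q :^ 3 := q :* (q :* q)) refl
    n^8≡n⁴n⁴ : ∀ n → n ^ 8 ≡ (n * n) * (n * n) * ((n * n) * (n * n))
    n^8≡n⁴n⁴ = solve 1 (λ n → n :^ 8 := (n :* n) :* (n :* n) :* ((n :* n) :* (n :* n))) refl
    error≡ : ∀ n q → 5 * q ^ 3 * (n ^ 6 + q ^ 2 * n ^ 5) ≡ 5 * (q * (q * q) * (n * n * ((n * n) * (n * n)) + q * q * (n * ((n * n) * (n * n)))))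
    error≡ = solve 2 (λ n q → con 5 :* q :^ 3 :* (n :^ 6 :+ q :^ 2 :* n :^ 5)
                         := con 5 :* (q :* (q :* q) :* (n :* n :* ((n :* n) :* (n :* n)) :+ q :* q :* (n :* ((n :* n) :* (n :* n)))))) refl

open import Data.Nat using (ℕ; _*_; _^_; _+_; _≤_; _<_)
open import Data.Integer using (+_; ∣_∣) renaming (_-_ to _⊖ℤ_)

theorem1p4 : Σ ℕ λ C → 0 < C ×
    ((q : ℕ) (F : FiniteField q) (E : List (FiniteField.Point F)) → Unique E →
      ∣ + (q ^ 3 * FiniteField.L² F E) ⊖ℤ + (length E ^ 8) ∣
        ≤ C * q ^ 3 * (length E ^ 6 + q ^ 2 * length E ^ 5))
theorem1p4 = 5 , ℕ.s≤s ℕ.z≤n , λ q F E E-unique →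
  let open Incidences F E E-unique
      open Estimates n q (Plane.0<q F) n≤q²
      lineEnergy-bound = lineEnergy≤ lineEnergy-moment lineSum≤ length-nonzeroPoints
      offDiagonal-bound = q*offDiagonalSum≤n⁴+3q³n² q*offDiagonalSum≤ offDiagonalSum≤ lineEnergy-bound
      mass-bound = q*mass≤n⁴+5q³n² mass≤ offDiagonal-bound
  in deviation≤ L²≤energy energy≤ (n⁸≤q³energy q*n⁸≤q⁴*energy) (q³energy≤ energy-moment mass-bound)
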